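{- Let $n\ge5$ be an odd integer, let $s_1\in\mathbb{Z}_n$ with $1<s_1\le (n-1)/2$, and let $S\subseteq\mathbb{Z}_n\setminus\{0\}$ satisfy $-S=S$, $1,s_1\in S$, and either $S\cap\{2,3\}=\emptyset$ or $|S|\ge6$. Let $\Gamma=\mathrm{Circ}(n;S)$ and let $a\in\mathbb{Z}_n\setminus\{n-1,0,s_1-1,s_1\}$ be such that $\Gamma-\{0,s_1,a,a+1\}$ has no fractional perfect matching. Then $s_1$ is even.
   Context: Elements of $\mathbb{Z}_n$ are identified with the integers $0,1,\dots,n-1$, and inequalities and parity refer to these representatives. $\mathrm{Circ}(n;S)$ is the graph with vertex set $\mathbb{Z}_n$ in which $i$ is adjacent to $i+s$ for each $s\in S$. For a vertex set $U$, $\Gamma-U$ is the subgraph induced on the remaining vertices. A fractional perfect matching of a graph $(V,E)$ is a function $f:E\to[0,1]$ such that for every vertex $v$ the sum of $f(e)$ over edges incident to $v$ equals $1$. -}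

module Defs where

open import Data.Nat using (ℕ; zero; suc; _∸_; NonZero) renaming (_+_ to _+ℕ_)
open import Data.Nat.DivMod using (_mod_)
open import Data.Fin using (Fin; toℕ; _≟_)
open import Data.Fin.Subset using (Subset; _∈_; _∉_; ⁅_⁆; _∪_)
open import Data.Fin.Subset.Properties using (_∈?_)
open import Data.Fin.Properties using (any?)
open import Data.Product using (∃; _×_; _,_)
open import Data.Rational using (ℚ; 0ℚ; 1ℚ; _≤_) renaming (_+_ to _+ℚ_)
open import Relation.Binary.PropositionalEquality using (_≡_)
open import Relation.Nullary using (Dec; yes; no; ¬_)
open import Relation.Nullary.Decidable using (_×-dec_; ¬?)

module _ (n : ℕ) .{{_ : NonZero n}} where

  ⟦_⟧ : ℕ → Fin n
  ⟦ k ⟧ = k mod n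

  add : Fin n → Fin n → Fin n
  add i j = (toℕ i +ℕ toℕ j) mod n

  neg : Fin n → Fin n
  neg i = (n ∸ toℕ i) mod n

  sub : Fin n → Fin n → Fin n
  sub i j = add i (neg j)

  Adj : Subset n → Fin n → Fin n → Set
  Adj S u v = ∃ λ s → s ∈ S × v ≡ add u s

  adj? : (S : Subset n) → (u v : Fin n) → Dec (Adj S u v)
  adj? S u v = any? (λ s → (s ∈? S) ×-dec (v ≟ add u s))

sumFin : (m : ℕ) → (Fin m → ℚ) → ℚ
sumFin zero    f = 0ℚ
sumFin (suc m) f = f Fin.zero +ℚ sumFin m (λ i → f (Fin.suc i))

-- Sum of f(v,u) over the neighbours u of v in Circ(n;S) - U (v itself is
-- assumed to lie outside U).  Each edge {v,u} of the induced subgraph is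
-- counted exactly once.
incidentSum : (n : ℕ) .{{_ : NonZero n}} → Subset n → Subset n →
              (Fin n → Fin n → ℚ) → Fin n → ℚ
incidentSum n S U f v = sumFin n term
  where
  term : Fin n → ℚ
  term u with u ∈? U | adj? n S v u
  ... | no _  | yes _ = f v u
  ... | _     | _     = 0ℚ

-- An edge function is
-- represented as a symmetric function f on ordered pairs of vertices; its
-- values on non-edges are irrelevant (required to be in [0,1] as well, which
-- is harmless since they can be set to 0).
record FractionalPerfectMatching (n : ℕ) .{{_ : NonZero n}}
         (S U : Subset n) : Set where
  field
    f     : Fin n → Fin n → ℚ
    symm  : ∀ u v → f u v ≡ f v u
    nonneg : ∀ u v → 0ℚ ≤ f u v
    le1   : ∀ u v → f u v ≤ 1ℚ
    sum1  : ∀ v → v ∉ U → incidentSum n S U f v ≡ 1ℚ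

set4 : {n : ℕ} → Fin n → Fin n → Fin n → Fin n → Subset n
set4 a b c d = ⁅ a ⁆ ∪ (⁅ b ⁆ ∪ (⁅ c ⁆ ∪ ⁅ d ⁆))

{-# OPTIONS --safe #-}
-- Suppose s is odd. Then Γ − {0, s, a, a + 1} has a fractional perfect matching with values in
-- {0, ½, 1}, built from the Hamiltonian cycle 0, 1, …, n − 1 and chords of length s. The removed
-- vertices cut the cycle into paths; each path is either matched in consecutive pairs or gets
-- weight ½ on all its edges, and the ends of the paths of the second kind are joined by chords, so
-- that they close up into cycles of weight ½ (one of them odd, as n − 4 is odd). Which layout works
-- depends on whether a lies below or above s, on parities, and on how much n exceeds 2s. When s = 3
-- and a is 1, 4 or n − 2, chords of length 3 alone do not suffice; then |S| ≥ 6 provides a second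
-- length t ∈ S with 2 ≤ t, t ≠ 3 and 2t < n.
module Submission where

open import Defs
open import Data.Bool using (Bool; true; false; if_then_else_; T; T?; _∧_; _∨_; not)
open import Data.Bool.Properties using (T-∧)
import Data.Fin as Fin
open import Data.Fin using (Fin; toℕ)
open import Data.Fin.Properties using (toℕ-injective; toℕ<n; toℕ-fromℕ<; any?)
open import Data.Fin.Subset using (Subset; _∈_; _∉_; ∣_∣; ⁅_⁆; _∪_; ⊥; _⊆_; inside; outside)
open import Data.Fin.Subset.Properties
  using (_∈?_; x∈p∪q⁻; x∈p∪q⁺; x∈⁅x⁆; x∈⁅y⁆⇒x≡y; ∣⊥∣≡0; ∣⁅x⁆∣≡1; p⊆q⇒∣p∣≤∣q∣; ∣p∣≤∣x∷p∣)
open import Data.List using (List; []; _∷_; length; map; filter; upTo; foldr)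
open import Data.List.Membership.Propositional using () renaming (_∈_ to _∈ₗ_; _∉_ to _∉ₗ_)
open import Data.List.Membership.Propositional.Properties using (∈-map⁺; ∈-map⁻; ∈-filter⁺; ∈-filter⁻; ∈-upTo⁺; ∈-upTo⁻)
open import Data.List.Relation.Binary.Permutation.Propositional using (_↭_; prep; ↭-sym; ↭-refl)
import Data.List.Relation.Binary.Permutation.Propositional.Properties as ↭
open import Data.List.Relation.Unary.All as All using (All)
open import Data.List.Relation.Unary.Any as Any using (here; there)
open import Data.Nat using (ℕ; zero; suc; _+_; _*_; _∸_; _≤_; _<_; _/_; _%_; NonZero; z≤n; s≤s; _≟_; _<?_; _≤?_; _≡ᵇ_)
open import Data.Nat.Divisibility using (_∣_; _∣?_; divides; n∣m⇒m%n≡0)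
open import Data.Nat.DivMod using (m<n⇒m%n≡m; [m+n]%n≡m%n; %-distribˡ-+; m%n%n≡m%n; m*n/n≡m)
open import Data.Nat.Properties
open import Data.Nat.Tactic.RingSolver using (solve-∀; solve)
open import Data.Product using (_×_; _,_; proj₁; proj₂; ∃; ∃₂; Σ-syntax)
open import Data.Product.Properties using (≡-dec)
open import Data.Rational using (ℚ; 0ℚ; 1ℚ; ½) renaming (_+_ to _+ℚ_; _≤_ to _≤ℚ_; _≤?_ to _≤ℚ?_)
import Data.Rational.Properties as ℚ
open import Data.Sum using (_⊎_; inj₁; inj₂)
open import Data.Unit using (tt)
import Data.Vec as Vec
open import Function using (_∘_)
open import Function.Bundles using (Equivalence)
open import Relation.Binary.Definitions using (DecidableEquality)
open import Relation.Binary.PropositionalEquality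
open import Relation.Nullary using (¬_; Dec; yes; no; does)
open import Relation.Nullary.Decidable using (_×-dec_; ¬?; toWitness; dec-true; dec-false; decidable-stable)
open import Relation.Nullary.Negation using (contradiction)
open import Algebra.Properties.CommutativeMonoid.Sum +-0-commutativeMonoid
  using (sum; sum-syntax; sum-cong-≗; ∑-distrib-+; sum-replicate-zero)

-- Half-integral weights

half : ℕ → ℚ
half zero    = 0ℚ
half (suc m) = ½ +ℚ half m

half-+ : ∀ m k → half (m + k) ≡ half m +ℚ half k
half-+ zero    k = sym (ℚ.+-identityˡ (half k))
half-+ (suc m) k = trans (cong (½ +ℚ_) (half-+ m k)) (sym (ℚ.+-assoc ½ (half m) (half k)))

unit-interval? : (q : ℚ) → Dec (0ℚ ≤ℚ q × q ≤ℚ 1ℚ)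
unit-interval? q = (0ℚ ≤ℚ? q) ×-dec (q ≤ℚ? 1ℚ)

half-bounded : ∀ m → m ≤ 2 → 0ℚ ≤ℚ half m × half m ≤ℚ 1ℚ
half-bounded 0 _ = toWitness {a? = unit-interval? (half 0)} _
half-bounded 1 _ = toWitness {a? = unit-interval? (half 1)} _
half-bounded 2 _ = toWitness {a? = unit-interval? (half 2)} _
half-bounded (suc (suc (suc _))) (s≤s (s≤s ()))

sumFin-cong : ∀ m {g h : Fin m → ℚ} → (∀ i → g i ≡ h i) → sumFin m g ≡ sumFin m h
sumFin-cong zero    g≗h = refl
sumFin-cong (suc m) g≗h = cong₂ _+ℚ_ (g≗h Fin.zero) (sumFin-cong m (g≗h ∘ Fin.suc))

sumFin-half : ∀ m (g : Fin m → ℕ) → sumFin m (half ∘ g) ≡ half (sum g)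
sumFin-half zero    g = refl
sumFin-half (suc m) g = begin
  half (g Fin.zero) +ℚ sumFin m (half ∘ g ∘ Fin.suc) ≡⟨ cong (half (g Fin.zero) +ℚ_) (sumFin-half m (g ∘ Fin.suc)) ⟩
  half (g Fin.zero) +ℚ half (sum (g ∘ Fin.suc))       ≡⟨ half-+ (g Fin.zero) (sum (g ∘ Fin.suc)) ⟨
  half (sum g)                                        ∎
  where open ≡-Reasoning

term≤sum : ∀ {m} (g : Fin m → ℕ) i → g i ≤ sum g
term≤sum g Fin.zero    = m≤m+n (g Fin.zero) _
term≤sum g (Fin.suc i) = ≤-trans (term≤sum (g ∘ Fin.suc) i) (m≤n+m _ (g Fin.zero))

module _ (n : ℕ) .{{_ : NonZero n}} (S U : Subset n) (f : Fin n → Fin n → ℚ) (v : Fin n)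
         (f-removed : ∀ u → u ∈ U → f v u ≡ 0ℚ) (f-nonadjacent : ∀ u → ¬ Adj n S v u → f v u ≡ 0ℚ) where

  mutual
    incidentSum-total : incidentSum n S U f v ≡ sumFin n (f v)
    incidentSum-total = sumFin-cong n incidentSum-summand

    -- The left-hand side is the summand of incidentSum, a with-function that cannot be named.
    incidentSum-summand : (u : Fin n) → _ ≡ f v u
    incidentSum-summand u with u ∈? U | adj? n S v u
    ... | yes u∈U | _       = sym (f-removed u u∈U)
    ... | no _    | yes _   = refl
    ... | no _    | no ¬adj = sym (f-nonadjacent u ¬adj)

fpm-from-half-weights : (n : ℕ) .{{_ : NonZero n}} (S U : Subset n) (w : ℕ → ℕ → ℕ) →
  (∀ k j → w k j ≡ w j k) →
  (∀ k (u : Fin n) → u ∈ U → w k (toℕ u) ≡ 0) →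
  (∀ v u → ¬ Adj n S v u → w (toℕ v) (toℕ u) ≡ 0) →
  (∀ v → v ∉ U → ∑[ u < n ] w (toℕ v) (toℕ u) ≡ 2) →
  FractionalPerfectMatching n S U
fpm-from-half-weights n S U w w-sym w-removed w-nonadjacent w-degree = record
  { f      = f
  ; symm   = λ u v → cong half (w-sym (toℕ u) (toℕ v))
  ; nonneg = λ u v → proj₁ (half-bounded _ (w≤2 u v))
  ; le1    = λ u v → proj₂ (half-bounded _ (w≤2 u v))
  ; sum1   = λ v v∉U → begin
      incidentSum n S U f v                  ≡⟨ incidentSum-total n S U f v (λ u → cong half ∘ w-removed (toℕ v) u)
                                                                            (λ u → cong half ∘ w-nonadjacent v u) ⟩
      sumFin n (half ∘ w (toℕ v) ∘ toℕ)      ≡⟨ sumFin-half n (w (toℕ v) ∘ toℕ) ⟩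
      half (∑[ u < n ] w (toℕ v) (toℕ u))     ≡⟨ cong half (w-degree v v∉U) ⟩
      1ℚ                                     ∎
  }
  where
  open ≡-Reasoning
  f : Fin n → Fin n → ℚ
  f v u = half (w (toℕ v) (toℕ u))
  w≤2 : ∀ v u → w (toℕ v) (toℕ u) ≤ 2
  w≤2 v u with v ∈? U
  ... | yes v∈U = ≤-trans (≤-reflexive (trans (w-sym (toℕ v) (toℕ u)) (w-removed (toℕ u) v v∈U))) z≤n
  ... | no v∉U  = ≤-trans (term≤sum {n} (w (toℕ v) ∘ toℕ) u) (≤-reflexive (w-degree v v∉U))

-- Layouts of a path

𝟙 : ∀ {p} {P : Set p} → Dec P → ℕ
𝟙 P? = if does P? then 1 else 0

𝟙-yes : ∀ {p} {P : Set p} (P? : Dec P) → P → 𝟙 P? ≡ 1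
𝟙-yes P? p = cong (if_then 1 else 0) (dec-true P? p)

𝟙-no : ∀ {p} {P : Set p} (P? : Dec P) → ¬ P → 𝟙 P? ≡ 0
𝟙-no P? ¬p = cong (if_then 1 else 0) (dec-false P? ¬p)

δ : ℕ → ℕ → ℕ
δ a b = 𝟙 (a ≟ b)

δ-refl : ∀ a → δ a a ≡ 1
δ-refl a = 𝟙-yes (a ≟ a) refl

δ-sym : ∀ a b → δ a b ≡ δ b a
δ-sym a b with a ≟ b
... | yes refl = refl
... | no a≢b   = trans (𝟙-no (a ≟ b) a≢b) (sym (𝟙-no (b ≟ a) (a≢b ∘ sym)))

δ-+ˡ : ∀ c a b → δ (c + a) (c + b) ≡ δ a b
δ-+ˡ zero    a b = refl
δ-+ˡ (suc c) a b = δ-+ˡ c a b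

<-or-≡ : ∀ {m l} → m ≤ l → 𝟙 (m <? l) + δ m l ≡ 1
<-or-≡ {m} {l} m≤l with m ≟ l
... | yes refl = cong₂ _+_ (𝟙-no (m <? m) (<-irrefl refl)) (δ-refl m)
... | no m≢l   = cong₂ _+_ (𝟙-yes (m <? l) (≤∧≢⇒< m≤l m≢l)) (𝟙-no (m ≟ l) m≢l)

atPred : (ℕ → ℕ) → ℕ → ℕ
atPred g zero    = 0
atPred g (suc m) = g m

-- A layout cuts 0, …, N − 1 into consecutive blocks: a hole is a removed vertex, halfPath l is a path on
-- l + 1 vertices whose edges get weight ½ and whose two ends are closed up by chords, and pairs l is 2l
-- vertices matched in consecutive pairs. Weights are counted in halves, and edgeWeight b m is the weight
-- of the edge {m, m + 1}, counted from the start of the block.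
data Block : Set where
  hole     : Block
  halfPath : ℕ → Block
  pairs    : ℕ → Block

size : Block → ℕ
size hole         = 1
size (halfPath l) = suc l
size (pairs l)    = l + l

pairsWeight : ℕ → ℕ → ℕ
pairsWeight zero    _             = 0
pairsWeight (suc l) zero          = 2
pairsWeight (suc l) (suc zero)    = 0
pairsWeight (suc l) (suc (suc m)) = pairsWeight l m

edgeWeight : Block → ℕ → ℕ
edgeWeight hole         _ = 0
edgeWeight (halfPath l) m = 𝟙 (m <? l)
edgeWeight (pairs l)    m = pairsWeight l m

endDemand : Block → ℕ → ℕ
endDemand (halfPath l) m = δ m 0 + δ m l
endDemand _            _ = 0

halfPath-degree : ∀ l m → m ≤ l → 𝟙 (m <? l) + atPred (λ x → 𝟙 (x <? l)) m + (δ m 0 + δ m l) ≡ 2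
halfPath-degree l zero    _   = begin
  𝟙 (0 <? l) + 0 + (1 + δ 0 l) ≡⟨ cong (_+ suc (δ 0 l)) (+-identityʳ _) ⟩
  𝟙 (0 <? l) + suc (δ 0 l)     ≡⟨ +-suc (𝟙 (0 <? l)) (δ 0 l) ⟩
  suc (𝟙 (0 <? l) + δ 0 l)     ≡⟨ cong suc (<-or-≡ {l = l} z≤n) ⟩
  2                            ∎
  where open ≡-Reasoning
halfPath-degree l (suc m) m<l = begin
  𝟙 (suc m <? l) + 𝟙 (m <? l) + δ (suc m) l ≡⟨ cong (λ x → 𝟙 (suc m <? l) + x + δ (suc m) l) (𝟙-yes (m <? l) m<l) ⟩
  𝟙 (suc m <? l) + 1 + δ (suc m) l          ≡⟨ cong (_+ δ (suc m) l) (+-comm (𝟙 (suc m <? l)) 1) ⟩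
  suc (𝟙 (suc m <? l) + δ (suc m) l)        ≡⟨ cong suc (<-or-≡ m<l) ⟩
  2                                         ∎
  where open ≡-Reasoning

pairsWeight-suc : ∀ l m → pairsWeight (suc l) (suc m) ≡ atPred (pairsWeight l) m
pairsWeight-suc l zero    = refl
pairsWeight-suc l (suc m) = refl

pairs-degree : ∀ l m → m < l + l → pairsWeight l m + atPred (pairsWeight l) m ≡ 2
pairs-degree (suc l) zero          _ = refl
pairs-degree (suc l) (suc zero)    _ = refl
pairs-degree (suc l) (suc (suc m)) m<2l = begin
  pairsWeight l m + pairsWeight (suc l) (suc m) ≡⟨ cong (pairsWeight l m +_) (pairsWeight-suc l m) ⟩
  pairsWeight l m + atPred (pairsWeight l) m    ≡⟨ pairs-degree l m (≤-pred (subst (suc (suc m) ≤_) (+-suc l l) (≤-pred m<2l))) ⟩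
  2                                             ∎
  where open ≡-Reasoning

block-degree : ∀ b m → b ≢ hole → m < size b → edgeWeight b m + atPred (edgeWeight b) m + endDemand b m ≡ 2
block-degree hole         m b≢hole _   = contradiction refl b≢hole
block-degree (halfPath l) m _      m<b = halfPath-degree l m (≤-pred m<b)
block-degree (pairs l)    m _      m<b = trans (+-identityʳ _) (pairs-degree l m m<b)

pairsWeight-last : ∀ l m → l + l ≤ suc m → pairsWeight l m ≡ 0
pairsWeight-last zero    m             _    = refl
pairsWeight-last (suc l) zero          2l≤1 = contradiction (subst (_≤ 0) (+-suc l l) (≤-pred 2l≤1)) λ ()
pairsWeight-last (suc l) (suc zero)    _    = refl
pairsWeight-last (suc l) (suc (suc m)) 2l≤m = pairsWeight-last l m (≤-pred (subst (_≤ suc (suc m)) (+-suc l l) (≤-pred 2l≤m)))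

edgeWeight-last : ∀ b m → size b ≤ suc m → edgeWeight b m ≡ 0
edgeWeight-last hole         m _   = refl
edgeWeight-last (halfPath l) m l≤m = 𝟙-no (m <? l) (≤⇒≯ (≤-pred l≤m))
edgeWeight-last (pairs l)    m b≤m = pairsWeight-last l m b≤m

total : List Block → ℕ
total []       = 0
total (b ∷ bs) = size b + total bs

start : List Block → ℕ → ℕ
start []       _       = 0
start (b ∷ bs) zero    = 0
start (b ∷ bs) (suc i) = size b + start bs i

start-zero : ∀ bs → start bs 0 ≡ 0
start-zero []       = refl
start-zero (_ ∷ _) = refl

-- Indices beyond the end of the layout give a hole.
block : List Block → ℕ → Block
block []       _       = hole
block (b ∷ bs) zero    = b
block (b ∷ bs) (suc i) = block bs i

pathWeight : List Block → ℕ → ℕ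
pathWeight []       x = 0
pathWeight (b ∷ bs) x = if does (x <? size b) then edgeWeight b x else pathWeight bs (x ∸ size b)

record Location (bs : List Block) (x : ℕ) : Set where
  constructor at
  field
    index        : ℕ
    offset       : ℕ
    index<length : index < length bs
    offset<size  : offset < size (block bs index)
    position     : x ≡ start bs index + offset

locate : ∀ bs x → x < total bs → Location bs x
locate (b ∷ bs) x x<total with x <? size b
... | yes x<b = at 0 x (s≤s z≤n) x<b refl
... | no x≮b  = shift (locate bs (x ∸ size b) (+-cancelˡ-< (size b) _ _ (subst (_< size b + total bs) (sym b+[x∸b]≡x) x<total)))
  where
  b+[x∸b]≡x : size b + (x ∸ size b) ≡ x
  b+[x∸b]≡x = m+[n∸m]≡n (≮⇒≥ x≮b)
  shift : Location bs (x ∸ size b) → Location (b ∷ bs) x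
  shift (at i m i<len m<size eq) = at (suc i) m (s≤s i<len) m<size
    (trans (sym b+[x∸b]≡x) (trans (cong (size b +_) eq) (sym (+-assoc (size b) (start bs i) m))))

start-injective : ∀ bs {i j m m′} → i < length bs → j < length bs → m < size (block bs i) → m′ < size (block bs j) →
                  start bs i + m ≡ start bs j + m′ → i ≡ j
start-injective (b ∷ bs) {zero}  {zero}  _ _ _ _ _ = refl
start-injective (b ∷ bs) {zero}  {suc j} {m} {m′} _ _ m<b _ eq =
  contradiction (subst (_< size b) (trans eq (+-assoc (size b) (start bs j) m′)) m<b) (m+n≮m (size b) _)
start-injective (b ∷ bs) {suc i} {zero}  {m} {m′} _ _ _ m′<b eq =
  contradiction (subst (_< size b) (trans (sym eq) (+-assoc (size b) (start bs i) m)) m′<b) (m+n≮m (size b) _)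
start-injective (b ∷ bs) {suc i} {suc j} {m} {m′} (s≤s i<len) (s≤s j<len) m<b m′<b eq =
  cong suc (start-injective bs i<len j<len m<b m′<b
    (+-cancelˡ-≡ (size b) _ _ (trans (sym (+-assoc (size b) (start bs i) m)) (trans eq (+-assoc (size b) (start bs j) m′)))))

start+size≤total : ∀ bs {i} → i < length bs → start bs i + size (block bs i) ≤ total bs
start+size≤total (b ∷ bs) {zero}  _           = m≤m+n (size b) (total bs)
start+size≤total (b ∷ bs) {suc i} (s≤s i<len) =
  subst (_≤ size b + total bs) (sym (+-assoc (size b) (start bs i) _)) (+-monoʳ-≤ (size b) (start+size≤total bs i<len))

pathWeight-at : ∀ bs i m → m < size (block bs i) → pathWeight bs (start bs i + m) ≡ edgeWeight (block bs i) m
pathWeight-at []       i       m _   = refl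
pathWeight-at (b ∷ bs) zero    m m<b rewrite dec-true (m <? size b) m<b = refl
pathWeight-at (b ∷ bs) (suc i) m m<b
  rewrite +-assoc (size b) (start bs i) m
        | dec-false (size b + (start bs i + m) <? size b) (m+n≮m (size b) _)
        | m+n∸m≡n (size b) (start bs i + m) = pathWeight-at bs i m m<b

pathWeight-before-start : ∀ bs i x → suc x ≡ start bs i → pathWeight bs x ≡ 0
pathWeight-before-start []       i       x _  = refl
pathWeight-before-start (b ∷ bs) (suc i) x eq with x <? size b
... | yes x<b rewrite dec-true (x <? size b) x<b = edgeWeight-last b x (subst (size b ≤_) (sym eq) (m≤m+n (size b) (start bs i)))
... | no x≮b  rewrite dec-false (x <? size b) x≮b = pathWeight-before-start bs i (x ∸ size b) (begin
  suc (x ∸ size b)          ≡⟨ +-∸-assoc 1 (≮⇒≥ x≮b) ⟨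
  suc x ∸ size b            ≡⟨ cong (_∸ size b) eq ⟩
  size b + start bs i ∸ size b ≡⟨ m+n∸m≡n (size b) (start bs i) ⟩
  start bs i                ∎)
  where open ≡-Reasoning

-- On a concrete layout these unfold to the sizes of the preceding blocks summed from the left, which is
-- how positions are written when layouts are used.
startFrom : ℕ → List Block → ℕ → ℕ
startFrom c []       _       = c
startFrom c (b ∷ bs) zero    = c
startFrom c (b ∷ bs) (suc i) = startFrom (c + size b) bs i

totalFrom : ℕ → List Block → ℕ
totalFrom c []       = c
totalFrom c (b ∷ bs) = totalFrom (c + size b) bs

startFrom-≡ : ∀ c bs i → startFrom c bs i ≡ c + start bs i
startFrom-≡ c []       i       = sym (+-identityʳ c)
startFrom-≡ c (b ∷ bs) zero    = sym (+-identityʳ c)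
startFrom-≡ c (b ∷ bs) (suc i) = trans (startFrom-≡ (c + size b) bs i) (+-assoc c (size b) (start bs i))

totalFrom-≡ : ∀ c bs → totalFrom c bs ≡ c + total bs
totalFrom-≡ c []       = sym (+-identityʳ c)
totalFrom-≡ c (b ∷ bs) = trans (totalFrom-≡ (c + size b) bs) (+-assoc c (size b) (total bs))

start-suc : ∀ bs {i} → i < length bs → start bs (suc i) ≡ start bs i + size (block bs i)
start-suc (b ∷ bs) {zero}  _           = trans (cong (size b +_) (start-zero bs)) (+-identityʳ (size b))
start-suc (b ∷ bs) {suc i} (s≤s i<len) = trans (cong (size b +_) (start-suc bs i<len)) (sym (+-assoc (size b) (start bs i) _))

data Side : Set where
  left right : Side

_≟ˢ_ : DecidableEquality Side
left  ≟ˢ left  = yes refl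
left  ≟ˢ right = no λ ()
right ≟ˢ left  = no λ ()
right ≟ˢ right = yes refl

End : Set
End = ℕ × Side

_≟ᴱ_ : DecidableEquality End
_≟ᴱ_ = ≡-dec _≟_ _≟ˢ_

Chord : Set
Chord = End × End

sideOffset : Block → Side → ℕ
sideOffset b            left  = 0
sideOffset (halfPath l) right = l
sideOffset _            right = 0

endpoint : List Block → End → ℕ
endpoint bs (i , side) = start bs i + sideOffset (block bs i) side

endpointˡ : List Block → End → ℕ
endpointˡ bs (i , left)  = startFrom 0 bs i
endpointˡ bs (i , right) = startFrom 0 bs i + sideOffset (block bs i) right

endpoint≡endpointˡ : ∀ bs e → endpoint bs e ≡ endpointˡ bs e
endpoint≡endpointˡ bs (i , left)  = trans (+-identityʳ (start bs i)) (sym (startFrom-≡ 0 bs i))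
endpoint≡endpointˡ bs (i , right) = cong (_+ sideOffset (block bs i) right) (sym (startFrom-≡ 0 bs i))

isHalfPath : Block → Bool
isHalfPath (halfPath _) = true
isHalfPath _            = false

OnHalfPath : List Block → End → Set
OnHalfPath bs (i , _) = T (isHalfPath (block bs i))

onHalfPath-in-range : ∀ bs e → OnHalfPath bs e → proj₁ e < length bs
onHalfPath-in-range (b ∷ bs) (zero  , _)    _  = s≤s z≤n
onHalfPath-in-range (b ∷ bs) (suc i , side) on = s≤s (onHalfPath-in-range bs (i , side) on)

sideOffset<size : ∀ b side → T (isHalfPath b) → sideOffset b side < size b
sideOffset<size (halfPath l) left  _ = s≤s z≤n
sideOffset<size (halfPath l) right _ = ≤-refl

endpoint<total : ∀ bs e → OnHalfPath bs e → endpoint bs e < total bs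
endpoint<total bs (i , side) on = <-≤-trans (+-monoʳ-< (start bs i) (sideOffset<size (block bs i) side on))
                                            (start+size≤total bs (onHalfPath-in-range bs (i , side) on))

ChordsOnHalfPaths : List Block → List Chord → Set
ChordsOnHalfPaths bs = All (λ c → OnHalfPath bs (proj₁ c) × OnHalfPath bs (proj₂ c))

endCount : End → List Chord → ℕ
endCount e []               = 0
endCount e ((e₁ , e₂) ∷ cs) = 𝟙 (e₁ ≟ᴱ e) + 𝟙 (e₂ ≟ᴱ e) + endCount e cs

chordEnds : List Block → List Chord → ℕ → ℕ
chordEnds bs []               x = 0
chordEnds bs ((e₁ , e₂) ∷ cs) x = δ x (endpoint bs e₁) + δ x (endpoint bs e₂) + chordEnds bs cs x

allChordsOnHalfPaths : List Block → List Chord → Bool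
allChordsOnHalfPaths bs []                            = true
allChordsOnHalfPaths bs (((i , _) , (j , _)) ∷ cs) = isHalfPath (block bs i) ∧ isHalfPath (block bs j) ∧ allChordsOnHalfPaths bs cs

endsUsedOnce : List Block → ℕ → List Chord → Bool
endsUsedOnce []       i cs = true
endsUsedOnce (b ∷ bs) i cs =
  (not (isHalfPath b) ∨ ((endCount (i , left) cs ≡ᵇ 1) ∧ (endCount (i , right) cs ≡ᵇ 1))) ∧ endsUsedOnce bs (suc i) cs

-- A Boolean test, so that it is decided by evaluation for a concrete layout.
WellFormed : List Block → List Chord → Set
WellFormed bs cs = T (allChordsOnHalfPaths bs cs ∧ endsUsedOnce bs 0 cs)

allChordsOnHalfPaths-sound : ∀ bs cs → T (allChordsOnHalfPaths bs cs) → ChordsOnHalfPaths bs cs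
allChordsOnHalfPaths-sound bs []                            _  = All.[]
allChordsOnHalfPaths-sound bs (((i , _) , (j , _)) ∷ cs) ok
  with on-i , rest ← Equivalence.to T-∧ ok
  with on-j , ok′  ← Equivalence.to T-∧ rest
  = (on-i , on-j) All.∷ allChordsOnHalfPaths-sound bs cs ok′

endsUsedOnce-sound : ∀ bs i₀ cs → T (endsUsedOnce bs i₀ cs) → ∀ i side → T (isHalfPath (block bs i)) →
                     endCount (i₀ + i , side) cs ≡ 1
endsUsedOnce-sound (halfPath l ∷ bs) i₀ cs ok zero side on
  with counts , _ ← Equivalence.to (T-∧ {(endCount (i₀ , left) cs ≡ᵇ 1) ∧ (endCount (i₀ , right) cs ≡ᵇ 1)}) ok
  = subst (λ x → endCount (x , side) cs ≡ 1) (sym (+-identityʳ i₀)) (count side (Equivalence.to T-∧ counts))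
  where
  count : ∀ side → T (endCount (i₀ , left) cs ≡ᵇ 1) × T (endCount (i₀ , right) cs ≡ᵇ 1) → endCount (i₀ , side) cs ≡ 1
  count left  (l≡1 , _) = ≡ᵇ⇒≡ _ 1 l≡1
  count right (_ , r≡1) = ≡ᵇ⇒≡ _ 1 r≡1
endsUsedOnce-sound (b ∷ bs) i₀ cs ok (suc i) side on
  with _ , rest ← Equivalence.to (T-∧ {not (isHalfPath b) ∨ ((endCount (i₀ , left) cs ≡ᵇ 1) ∧ (endCount (i₀ , right) cs ≡ᵇ 1))}) ok
  = subst (λ x → endCount (x , side) cs ≡ 1) (sym (+-suc i₀ i)) (endsUsedOnce-sound bs (suc i₀) cs rest i side on)

pick-first : ∀ {p q} x y → p ≡ 1 → q ≡ 0 → p * x + q * y ≡ x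
pick-first x y refl refl = trans (+-identityʳ (1 * x)) (*-identityˡ x)

pick-second : ∀ {p q} x y → p ≡ 0 → q ≡ 1 → p * x + q * y ≡ y
pick-second x y refl refl = *-identityˡ y

pick-neither : ∀ {p q} x y → p ≡ 0 → q ≡ 0 → p * x + q * y ≡ 0
pick-neither x y refl refl = refl

endpoint-δ : ∀ bs {x} (loc : Location bs x) e → OnHalfPath bs e →
             let open Location loc in
             δ x (endpoint bs e) ≡ 𝟙 (e ≟ᴱ (index , left)) * δ offset 0
                                 + 𝟙 (e ≟ᴱ (index , right)) * δ offset (sideOffset (block bs index) right)
endpoint-δ bs (at i m i<len m<size refl) (i′ , side) on = by-index (i′ ≟ i) side on
  where
  r : ℕ
  r = sideOffset (block bs i) right
  by-index : Dec (i′ ≡ i) → ∀ side → OnHalfPath bs (i′ , side) →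
             δ (start bs i + m) (endpoint bs (i′ , side))
             ≡ 𝟙 ((i′ , side) ≟ᴱ (i , left)) * δ m 0 + 𝟙 ((i′ , side) ≟ᴱ (i , right)) * δ m r
  by-index (no i′≢i) side on =
    trans (𝟙-no (_ ≟ _) (i′≢i ∘ sym ∘ start-injective bs i<len (onHalfPath-in-range bs (i′ , side) on) m<size
                                                      (sideOffset<size (block bs i′) side on)))
          (sym (pick-neither (δ m 0) (δ m r) (𝟙-no (_ ≟ᴱ _) (i′≢i ∘ cong proj₁)) (𝟙-no (_ ≟ᴱ _) (i′≢i ∘ cong proj₁))))
  by-index (yes refl) left _ =
    trans (δ-+ˡ (start bs i) m 0)
          (sym (pick-first (δ m 0) (δ m r) (𝟙-yes ((i , left) ≟ᴱ _) refl) (𝟙-no ((i , left) ≟ᴱ (i , right)) λ ())))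
  by-index (yes refl) right _ =
    trans (δ-+ˡ (start bs i) m r)
          (sym (pick-second (δ m 0) (δ m r) (𝟙-no ((i , right) ≟ᴱ (i , left)) λ ()) (𝟙-yes ((i , right) ≟ᴱ _) refl)))

chordEnds-at : ∀ bs cs {x} (loc : Location bs x) → ChordsOnHalfPaths bs cs →
               let open Location loc in
               chordEnds bs cs x ≡ endCount (index , left) cs * δ offset 0
                                 + endCount (index , right) cs * δ offset (sideOffset (block bs index) right)
chordEnds-at bs []               loc All.[]                  = refl
chordEnds-at bs ((e₁ , e₂) ∷ cs) loc@(at i m _ _ _) ((on₁ , on₂) All.∷ ons) =
  trans (cong₂ _+_ (cong₂ _+_ (endpoint-δ bs loc e₁ on₁) (endpoint-δ bs loc e₂ on₂)) (chordEnds-at bs cs loc ons))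
        (collect (𝟙 (e₁ ≟ᴱ (i , left))) (𝟙 (e₁ ≟ᴱ (i , right))) (𝟙 (e₂ ≟ᴱ (i , left))) (𝟙 (e₂ ≟ᴱ (i , right)))
                 (endCount (i , left) cs) (endCount (i , right) cs) (δ m 0) (δ m (sideOffset (block bs i) right)))
  where
  collect : ∀ A₁ B₁ A₂ B₂ C D a b → (A₁ * a + B₁ * b) + (A₂ * a + B₂ * b) + (C * a + D * b) ≡ (A₁ + A₂ + C) * a + (B₁ + B₂ + D) * b
  collect = solve-∀

endCount-off-halfPath : ∀ bs cs i side → ChordsOnHalfPaths bs cs → ¬ T (isHalfPath (block bs i)) → endCount (i , side) cs ≡ 0
endCount-off-halfPath bs []               i side All.[]              _   = refl
endCount-off-halfPath bs ((e₁ , e₂) ∷ cs) i side ((on₁ , on₂) All.∷ ons) off =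
  cong₃-+ (𝟙-no (e₁ ≟ᴱ (i , side)) (λ { refl → off on₁ })) (𝟙-no (e₂ ≟ᴱ (i , side)) (λ { refl → off on₂ }))
          (endCount-off-halfPath bs cs i side ons off)
  where
  cong₃-+ : ∀ {a b c} → a ≡ 0 → b ≡ 0 → c ≡ 0 → a + b + c ≡ 0
  cong₃-+ refl refl refl = refl

demand-from-counts : ∀ b m L R → (T (isHalfPath b) → L ≡ 1 × R ≡ 1) → (¬ T (isHalfPath b) → L ≡ 0 × R ≡ 0) →
                     L * δ m 0 + R * δ m (sideOffset b right) ≡ endDemand b m
demand-from-counts (halfPath l) m L R once _ with refl , refl ← once tt = cong₂ _+_ (*-identityˡ (δ m 0)) (*-identityˡ (δ m l))
demand-from-counts hole         m L R _ none with refl , refl ← none (λ ()) = refl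
demand-from-counts (pairs l)    m L R _ none with refl , refl ← none (λ ()) = refl

chordEnds-demand : ∀ bs cs {x} → WellFormed bs cs → (loc : Location bs x) →
                   chordEnds bs cs x ≡ endDemand (block bs (Location.index loc)) (Location.offset loc)
chordEnds-demand bs cs wf loc@(at i m _ _ _) =
  trans (chordEnds-at bs cs loc ons)
        (demand-from-counts (block bs i) m _ _
          (λ on → endsUsedOnce-sound bs 0 cs once i left on , endsUsedOnce-sound bs 0 cs once i right on)
          (λ off → endCount-off-halfPath bs cs i left ons off , endCount-off-halfPath bs cs i right ons off))
  where
  ons : ChordsOnHalfPaths bs cs
  ons = allChordsOnHalfPaths-sound bs cs (proj₁ (Equivalence.to T-∧ wf))
  once : T (endsUsedOnce bs 0 cs)
  once = proj₂ (Equivalence.to (T-∧ {allChordsOnHalfPaths bs cs}) wf)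

δ-weighted-zero : ∀ {a b} c → (a ≡ b → c ≡ 0) → δ a b * c ≡ 0
δ-weighted-zero {a} {b} c c≡0 with a ≟ b
... | yes a≡b = trans (cong (_* c) (𝟙-yes (a ≟ b) a≡b)) (trans (*-identityˡ c) (c≡0 a≡b))
... | no a≢b  = cong (_* c) (𝟙-no (a ≟ b) a≢b)

∑-δ : ∀ n m (g : ℕ → ℕ) → ∑[ j < n ] (δ (toℕ j) m * g (toℕ j)) ≡ 𝟙 (m <? n) * g m
∑-δ zero    m       g = refl
∑-δ (suc n) zero    g = trans (cong (1 * g 0 +_) (sum-replicate-zero n)) (+-identityʳ (1 * g 0))
∑-δ (suc n) (suc m) g = ∑-δ n m (g ∘ suc)

edgeIndicator : ℕ → ℕ → ℕ → ℕ → ℕ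
edgeIndicator a b k j = δ k a * δ j b + δ k b * δ j a

chordWeight : List Block → List Chord → ℕ → ℕ → ℕ
chordWeight bs []               k j = 0
chordWeight bs ((e₁ , e₂) ∷ cs) k j = edgeIndicator (endpoint bs e₁) (endpoint bs e₂) k j + chordWeight bs cs k j

layoutWeight : List Block → List Chord → ℕ → ℕ → ℕ
layoutWeight bs cs k j = δ j (suc k) * pathWeight bs k + δ k (suc j) * pathWeight bs j + chordWeight bs cs k j

∑-edgeIndicator : ∀ n a b k → a < n → b < n → ∑[ j < n ] edgeIndicator a b k (toℕ j) ≡ δ k a + δ k b
∑-edgeIndicator n a b k a<n b<n = begin
  ∑[ j < n ] (δ k a * δ (toℕ j) b + δ k b * δ (toℕ j) a)
    ≡⟨ ∑-distrib-+ {n} (λ j → δ k a * δ (toℕ j) b) (λ j → δ k b * δ (toℕ j) a) ⟩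
  ∑[ j < n ] (δ k a * δ (toℕ j) b) + ∑[ j < n ] (δ k b * δ (toℕ j) a)
    ≡⟨ cong₂ _+_ (one-end a b b<n) (one-end b a a<n) ⟩
  δ k a + δ k b ∎
  where
  open ≡-Reasoning
  one-end : ∀ a b → b < n → ∑[ j < n ] (δ k a * δ (toℕ j) b) ≡ δ k a
  one-end a b b<n = begin
    ∑[ j < n ] (δ k a * δ (toℕ j) b) ≡⟨ sum-cong-≗ {n} (λ j → *-comm (δ k a) (δ (toℕ j) b)) ⟩
    ∑[ j < n ] (δ (toℕ j) b * δ k a) ≡⟨ ∑-δ n b (λ _ → δ k a) ⟩
    𝟙 (b <? n) * δ k a               ≡⟨ cong (_* δ k a) (𝟙-yes (b <? n) b<n) ⟩
    1 * δ k a                        ≡⟨ *-identityˡ (δ k a) ⟩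
    δ k a                            ∎

∑-chordWeight : ∀ n bs cs k → total bs ≡ n → ChordsOnHalfPaths bs cs →
                ∑[ j < n ] chordWeight bs cs k (toℕ j) ≡ chordEnds bs cs k
∑-chordWeight n bs []               k _        All.[]              = sum-replicate-zero n
∑-chordWeight n bs ((e₁ , e₂) ∷ cs) k total≡n ((on₁ , on₂) All.∷ ons) = begin
  ∑[ j < n ] (edgeIndicator (endpoint bs e₁) (endpoint bs e₂) k (toℕ j) + chordWeight bs cs k (toℕ j))
    ≡⟨ ∑-distrib-+ {n} (λ j → edgeIndicator (endpoint bs e₁) (endpoint bs e₂) k (toℕ j)) (λ j → chordWeight bs cs k (toℕ j)) ⟩
  ∑[ j < n ] edgeIndicator (endpoint bs e₁) (endpoint bs e₂) k (toℕ j) + ∑[ j < n ] chordWeight bs cs k (toℕ j)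
    ≡⟨ cong₂ _+_ (∑-edgeIndicator n _ _ k (in-range e₁ on₁) (in-range e₂ on₂)) (∑-chordWeight n bs cs k total≡n ons) ⟩
  δ k (endpoint bs e₁) + δ k (endpoint bs e₂) + chordEnds bs cs k ∎
  where
  open ≡-Reasoning
  in-range : ∀ e → OnHalfPath bs e → endpoint bs e < n
  in-range e on = subst (endpoint bs e <_) total≡n (endpoint<total bs e on)

∑-pathWeight : ∀ n (P : ℕ → ℕ) k →
               ∑[ j < n ] (δ (toℕ j) (suc k) * P k + δ k (suc (toℕ j)) * P (toℕ j))
               ≡ 𝟙 (suc k <? n) * P k + atPred (λ x → 𝟙 (x <? n) * P x) k
∑-pathWeight n P k = trans (∑-distrib-+ {n} (λ j → δ (toℕ j) (suc k) * P k) (λ j → δ k (suc (toℕ j)) * P (toℕ j)))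
                           (cong₂ _+_ (∑-δ n (suc k) (λ _ → P k)) (incoming k))
  where
  incoming : ∀ k → ∑[ j < n ] (δ k (suc (toℕ j)) * P (toℕ j)) ≡ atPred (λ x → 𝟙 (x <? n) * P x) k
  incoming zero    = sum-replicate-zero n
  incoming (suc k) = trans (sum-cong-≗ {n} (λ j → cong (_* P (toℕ j)) (δ-sym k (toℕ j)))) (∑-δ n k P)

layout-row-sum : ∀ n bs cs k → total bs ≡ n → ChordsOnHalfPaths bs cs →
                 ∑[ j < n ] layoutWeight bs cs k (toℕ j)
                 ≡ 𝟙 (suc k <? n) * pathWeight bs k + atPred (λ x → 𝟙 (x <? n) * pathWeight bs x) k + chordEnds bs cs k
layout-row-sum n bs cs k total≡n ons =
  trans (∑-distrib-+ {n} (λ j → δ (toℕ j) (suc k) * pathWeight bs k + δ k (suc (toℕ j)) * pathWeight bs (toℕ j))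
                     (λ j → chordWeight bs cs k (toℕ j)))
        (cong₂ _+_ (∑-pathWeight n (pathWeight bs) k) (∑-chordWeight n bs cs k total≡n ons))

isHole : Block → Bool
isHole hole = true
isHole _    = false

holeIndices : List Block → List ℕ
holeIndices bs = filter (λ i → T? (isHole (block bs i))) (upTo (length bs))

holes : List Block → List ℕ
holes bs = map (start bs) (holeIndices bs)

hole∈holes : ∀ bs {i} → i < length bs → T (isHole (block bs i)) → start bs i ∈ₗ holes bs
hole∈holes bs i<len is-hole = ∈-map⁺ (start bs) (∈-filter⁺ (λ i → T? (isHole (block bs i))) (∈-upTo⁺ i<len) is-hole)

∈holes⇒hole : ∀ bs {x} → x ∈ₗ holes bs → ∃₂ λ i (_ : i < length bs) → T (isHole (block bs i)) × x ≡ start bs i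
∈holes⇒hole bs x∈holes with i , i∈ , refl ← ∈-map⁻ (start bs) x∈holes
  with i∈upTo , is-hole ← ∈-filter⁻ (λ i → T? (isHole (block bs i))) i∈ = i , ∈-upTo⁻ i∈upTo , is-hole , refl

outgoing-weight : ∀ n bs {k} → total bs ≡ n → (loc : Location bs k) →
                  𝟙 (suc k <? n) * pathWeight bs k ≡ edgeWeight (block bs (Location.index loc)) (Location.offset loc)
outgoing-weight n bs total≡n (at i m i<len m<size refl) with suc (start bs i + m) <? n
... | yes k+1<n = begin
  𝟙 (suc (start bs i + m) <? n) * pathWeight bs (start bs i + m) ≡⟨ cong (_* pathWeight bs (start bs i + m)) (𝟙-yes (_ <? n) k+1<n) ⟩
  1 * pathWeight bs (start bs i + m)                             ≡⟨ *-identityˡ _ ⟩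
  pathWeight bs (start bs i + m)                                 ≡⟨ pathWeight-at bs i m m<size ⟩
  edgeWeight (block bs i) m                                      ∎
  where open ≡-Reasoning
... | no  k+1≮n = trans (cong (_* pathWeight bs (start bs i + m)) (𝟙-no (_ <? n) k+1≮n))
                        (sym (edgeWeight-last (block bs i) m (+-cancelˡ-≤ (start bs i) _ _ start+size≤start+m+1)))
  where
  open ≤-Reasoning hiding (start)
  start+size≤start+m+1 : start bs i + size (block bs i) ≤ start bs i + suc m
  start+size≤start+m+1 = begin
    start bs i + size (block bs i) ≤⟨ start+size≤total bs i<len ⟩
    total bs                       ≡⟨ total≡n ⟩
    n                              ≤⟨ ≮⇒≥ k+1≮n ⟩
    suc (start bs i + m)           ≡⟨ +-suc (start bs i) m ⟨
    start bs i + suc m             ∎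

incoming-weight : ∀ n bs {k} → k < n → (loc : Location bs k) →
                  atPred (λ x → 𝟙 (x <? n) * pathWeight bs x) k
                  ≡ atPred (edgeWeight (block bs (Location.index loc))) (Location.offset loc)
incoming-weight n bs k<n (at i (suc m) _ m<size refl) rewrite +-suc (start bs i) m = begin
  𝟙 (start bs i + m <? n) * pathWeight bs (start bs i + m)
    ≡⟨ cong (_* pathWeight bs (start bs i + m)) (𝟙-yes (_ <? n) (<-trans (n<1+n _) k<n)) ⟩
  1 * pathWeight bs (start bs i + m)                       ≡⟨ *-identityˡ _ ⟩
  pathWeight bs (start bs i + m)                           ≡⟨ pathWeight-at bs i m (<-trans (n<1+n m) m<size) ⟩
  edgeWeight (block bs i) m                                ∎
  where open ≡-Reasoning
incoming-weight n bs _ (at i zero _ _ refl) with start bs i + 0 in eq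
... | zero  = refl
... | suc x = trans (cong (𝟙 (x <? n) *_) (pathWeight-before-start bs i x (trans (sym eq) (+-identityʳ (start bs i)))))
                    (*-zeroʳ (𝟙 (x <? n)))

layout-degree : ∀ n bs cs k → total bs ≡ n → WellFormed bs cs → k < n → k ∉ₗ holes bs →
                ∑[ j < n ] layoutWeight bs cs k (toℕ j) ≡ 2
layout-degree n bs cs k total≡n wf k<n k∉holes = begin
  ∑[ j < n ] layoutWeight bs cs k (toℕ j)
    ≡⟨ layout-row-sum n bs cs k total≡n (allChordsOnHalfPaths-sound bs cs (proj₁ (Equivalence.to T-∧ wf))) ⟩
  𝟙 (suc k <? n) * pathWeight bs k + atPred (λ x → 𝟙 (x <? n) * pathWeight bs x) k + chordEnds bs cs k
    ≡⟨ cong₂ _+_ (cong₂ _+_ (outgoing-weight n bs total≡n loc) (incoming-weight n bs k<n loc)) (chordEnds-demand bs cs wf loc) ⟩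
  edgeWeight b m + atPred (edgeWeight b) m + endDemand b m
    ≡⟨ block-degree b m b≢hole m<size ⟩
  2 ∎
  where
  open ≡-Reasoning
  loc : Location bs k
  loc = locate bs k (subst (k <_) (sym total≡n) k<n)
  open Location loc renaming (index to i; offset to m; offset<size to m<size)
  b : Block
  b = block bs i
  b≢hole : b ≢ hole
  b≢hole b≡hole = k∉holes (subst (_∈ₗ holes bs) (sym k≡start) (hole∈holes bs index<length (subst (T ∘ isHole) (sym b≡hole) tt)))
    where
    k≡start : k ≡ start bs i
    k≡start = trans position (trans (cong (start bs i +_) (n<1⇒n≡0 (subst (m <_) (cong size b≡hole) m<size))) (+-identityʳ _))

layoutWeight-sym : ∀ bs cs k j → layoutWeight bs cs k j ≡ layoutWeight bs cs j k
layoutWeight-sym bs cs k j =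
  cong₂ _+_ (+-comm (δ j (suc k) * pathWeight bs k) _) (chordWeight-sym cs)
  where
  chordWeight-sym : ∀ cs → chordWeight bs cs k j ≡ chordWeight bs cs j k
  chordWeight-sym []               = refl
  chordWeight-sym ((e₁ , e₂) ∷ cs) = cong₂ _+_ (edgeIndicator-sym (endpoint bs e₁) (endpoint bs e₂)) (chordWeight-sym cs)
    where
    edgeIndicator-sym : ∀ a b → edgeIndicator a b k j ≡ edgeIndicator a b j k
    edgeIndicator-sym a b = trans (+-comm (δ k a * δ j b) _) (cong₂ _+_ (*-comm (δ k b) (δ j a)) (*-comm (δ k a) (δ j b)))

isHole⇒≡hole : ∀ {b} → T (isHole b) → b ≡ hole
isHole⇒≡hole {hole} _ = refl

layoutWeight-at-hole : ∀ bs cs k {i} → ChordsOnHalfPaths bs cs → i < length bs → T (isHole (block bs i)) →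
                       layoutWeight bs cs k (start bs i) ≡ 0
layoutWeight-at-hole bs cs k {i} ons i<len is-hole =
  cong₂ _+_ (cong₂ _+_ (δ-weighted-zero (pathWeight bs k) (λ eq → pathWeight-before-start bs i k (sym eq)))
                       (trans (cong (δ k (suc (start bs i)) *_) no-outgoing-edge) (*-zeroʳ (δ k (suc (start bs i))))))
            (no-chord cs ons)
  where
  0<size : 0 < size (block bs i)
  0<size = subst (λ b → 0 < size b) (sym (isHole⇒≡hole is-hole)) (s≤s z≤n)
  no-outgoing-edge : pathWeight bs (start bs i) ≡ 0
  no-outgoing-edge = begin
    pathWeight bs (start bs i)     ≡⟨ cong (pathWeight bs) (+-identityʳ (start bs i)) ⟨
    pathWeight bs (start bs i + 0) ≡⟨ pathWeight-at bs i 0 0<size ⟩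
    edgeWeight (block bs i) 0      ≡⟨ cong (λ b → edgeWeight b 0) (isHole⇒≡hole is-hole) ⟩
    0                              ∎
    where open ≡-Reasoning
  not-an-end : ∀ e → OnHalfPath bs e → start bs i ≢ endpoint bs e
  not-an-end (i′ , side) on eq
    with refl ← start-injective bs i<len (onHalfPath-in-range bs (i′ , side) on) 0<size
                                (sideOffset<size (block bs i′) side on) (trans (+-identityʳ _) eq)
    = subst (T ∘ isHalfPath) (isHole⇒≡hole is-hole) on
  no-chord : ∀ cs → ChordsOnHalfPaths bs cs → chordWeight bs cs k (start bs i) ≡ 0
  no-chord []               All.[]                  = refl
  no-chord ((e₁ , e₂) ∷ cs) ((on₁ , on₂) All.∷ ons) = cong₂ _+_
    (cong₂ _+_ (trans (cong (δ k (endpoint bs e₁) *_) (𝟙-no (start bs i ≟ endpoint bs e₂) (not-an-end e₂ on₂)))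
                      (*-zeroʳ (δ k (endpoint bs e₁))))
               (trans (cong (δ k (endpoint bs e₂) *_) (𝟙-no (start bs i ≟ endpoint bs e₁) (not-an-end e₁ on₁)))
                      (*-zeroʳ (δ k (endpoint bs e₂)))))
    (no-chord cs ons)

ChordsWithin : (ℕ → ℕ → Set) → List Block → List Chord → Set
ChordsWithin R bs = All (λ c → R (endpoint bs (proj₁ c)) (endpoint bs (proj₂ c)) × R (endpoint bs (proj₂ c)) (endpoint bs (proj₁ c)))

layoutWeight-support : ∀ bs cs (R : ℕ → ℕ → Set) → (∀ x → R x (suc x)) → (∀ x → R (suc x) x) → ChordsWithin R bs cs →
                       ∀ {k j} → ¬ R k j → layoutWeight bs cs k j ≡ 0
layoutWeight-support bs cs R step back chords {k} {j} ¬Rkj =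
  cong₂ _+_ (cong₂ _+_ (δ-weighted-zero (pathWeight bs k) (λ j≡k+1 → contradiction (subst (R k) (sym j≡k+1) (step k)) ¬Rkj))
                       (δ-weighted-zero (pathWeight bs j) (λ k≡j+1 → contradiction (subst (λ x → R x j) (sym k≡j+1) (back j)) ¬Rkj)))
            (no-chord cs chords)
  where
  not-both : ∀ a b → R a b → δ k a * δ j b ≡ 0
  not-both a b Rab = δ-weighted-zero (δ j b) (λ k≡a → 𝟙-no (j ≟ b) (λ j≡b → ¬Rkj (subst₂ R (sym k≡a) (sym j≡b) Rab)))
  no-chord : ∀ cs → ChordsWithin R bs cs → chordWeight bs cs k j ≡ 0
  no-chord []               All.[]                  = refl
  no-chord ((e₁ , e₂) ∷ cs) ((R₁₂ , R₂₁) All.∷ rs) = cong₂ _+_ (cong₂ _+_ (not-both _ _ R₁₂) (not-both _ _ R₂₁)) (no-chord cs rs)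

-- Layouts in a circulant

Spans : ℕ → ℕ → ℕ → ℕ → Set
Spans n x y d = x + d ≡ y ⊎ x + d ≡ y + n

spans-reverse : ∀ {n x y d} → d ≤ n → Spans n x y d → Spans n y x (n ∸ d)
spans-reverse {n} {x} {y} {d} d≤n (inj₁ x+d≡y) = inj₂ (begin
  y + (n ∸ d)       ≡⟨ cong (_+ (n ∸ d)) x+d≡y ⟨
  x + d + (n ∸ d)   ≡⟨ +-assoc x d (n ∸ d) ⟩
  x + (d + (n ∸ d)) ≡⟨ cong (x +_) (m+[n∸m]≡n d≤n) ⟩
  x + n             ∎)
  where open ≡-Reasoning
spans-reverse {n} {x} {y} {d} d≤n (inj₂ x+d≡y+n) = inj₁ (+-cancelʳ-≡ d _ _ (begin
  y + (n ∸ d) + d   ≡⟨ +-assoc y (n ∸ d) d ⟩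
  y + (n ∸ d + d)   ≡⟨ cong (y +_) (m∸n+n≡m d≤n) ⟩
  y + n             ≡⟨ x+d≡y+n ⟨
  x + d             ∎))
  where open ≡-Reasoning

spans⇒% : ∀ {n} .{{_ : NonZero n}} x {y} d → y < n → Spans n x y d → (x + d) % n ≡ y
spans⇒% x d y<n (inj₁ refl) = m<n⇒m%n≡m y<n
spans⇒% {n} x {y} d y<n (inj₂ eq) = trans (cong (_% n) eq) (trans ([m+n]%n≡m%n y n) (m<n⇒m%n≡m y<n))

toℕ-⟦⟧ : ∀ {n} .{{_ : NonZero n}} {c} → c < n → toℕ (⟦ n ⟧ c) ≡ c
toℕ-⟦⟧ c<n = trans (toℕ-fromℕ< _) (m<n⇒m%n≡m c<n)

toℕ-add-1 : ∀ {n} .{{_ : NonZero n}} (x : Fin n) → 1 < n → suc (toℕ x) < n → toℕ (add n x (⟦ n ⟧ 1)) ≡ suc (toℕ x)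
toℕ-add-1 x 1<n x+1<n =
  trans (toℕ-fromℕ< _) (spans⇒% (toℕ x) _ x+1<n (inj₁ (trans (cong (toℕ x +_) (toℕ-⟦⟧ 1<n)) (+-comm (toℕ x) 1))))

toℕ-sub-1 : ∀ {n} .{{_ : NonZero n}} (x : Fin n) {y} → 1 < n → toℕ x ≡ suc y → toℕ (sub n x (⟦ n ⟧ 1)) ≡ y
toℕ-sub-1 {n} x {y} 1<n x≡y+1 = trans (toℕ-fromℕ< _) (spans⇒% (toℕ x) _ y<n (inj₂ (begin
  toℕ x + toℕ (neg n (⟦ n ⟧ 1)) ≡⟨ cong₂ _+_ x≡y+1 (trans (toℕ-fromℕ< _) (cong (λ c → (n ∸ c) % n) (toℕ-⟦⟧ 1<n))) ⟩
  suc y + (n ∸ 1) % n           ≡⟨ cong (suc y +_) (m<n⇒m%n≡m n∸1<n) ⟩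
  suc y + (n ∸ 1)               ≡⟨ +-suc y (n ∸ 1) ⟨
  y + suc (n ∸ 1)               ≡⟨ cong (y +_) 1+[n∸1]≡n ⟩
  y + n                         ∎)))
  where
  open ≡-Reasoning
  1+[n∸1]≡n : suc (n ∸ 1) ≡ n
  1+[n∸1]≡n = m+[n∸m]≡n (<⇒≤ 1<n)
  n∸1<n : n ∸ 1 < n
  n∸1<n = subst (n ∸ 1 <_) 1+[n∸1]≡n (n<1+n (n ∸ 1))
  y<n : y < n
  y<n = <-trans (n<1+n y) (subst (_< n) x≡y+1 (toℕ<n x))

module Circulant (n : ℕ) .{{_ : NonZero n}} (S : Subset n) where

  adjacent : ∀ {v u d} → d ∈ S → Spans n (toℕ v) (toℕ u) (toℕ d) → Adj n S v u
  adjacent {v} {u} {d} d∈S spans = d , d∈S , toℕ-injective (sym (trans (toℕ-fromℕ< _) (spans⇒% (toℕ v) (toℕ d) (toℕ<n u) spans)))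

  adjacent-reverse : ∀ {v u d} → neg n d ∈ S → Spans n (toℕ v) (toℕ u) (toℕ d) → Adj n S u v
  adjacent-reverse {v} {u} {d} -d∈S spans = neg n d , -d∈S , toℕ-injective (sym (begin
    toℕ (add n u (neg n d))                ≡⟨ toℕ-fromℕ< _ ⟩
    (toℕ u + toℕ (neg n d)) % n            ≡⟨ cong (λ x → (toℕ u + x) % n) (toℕ-fromℕ< _) ⟩
    (toℕ u + (n ∸ toℕ d) % n) % n          ≡⟨ %-distribˡ-+ (toℕ u) _ n ⟩
    (toℕ u % n + (n ∸ toℕ d) % n % n) % n  ≡⟨ cong (λ x → (toℕ u % n + x) % n) (m%n%n≡m%n (n ∸ toℕ d) n) ⟩
    (toℕ u % n + (n ∸ toℕ d) % n) % n      ≡⟨ %-distribˡ-+ (toℕ u) _ n ⟨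
    (toℕ u + (n ∸ toℕ d)) % n              ≡⟨ spans⇒% (toℕ u) (n ∸ toℕ d) (toℕ<n v) (spans-reverse (<⇒≤ (toℕ<n d)) spans) ⟩
    toℕ v                                  ∎))
    where open ≡-Reasoning

  chord : ∀ x y {D} d → d ∈ S → toℕ d ≡ D → x + D ≡ y → ∃ λ d → d ∈ S × Spans n x y (toℕ d)
  chord x y d d∈S d≡ x+D≡y = d , d∈S , inj₁ (trans (cong (x +_) d≡) x+D≡y)

  wrapping-chord : ∀ x y {D N} d → d ∈ S → toℕ d ≡ D → n ≡ N → x + D ≡ y + N → ∃ λ d → d ∈ S × Spans n x y (toℕ d)
  wrapping-chord x y d d∈S d≡ n≡ x+D≡y+N = d , d∈S , inj₂ (trans (cong (x +_) d≡) (trans x+D≡y+N (cong (y +_) (sym n≡))))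

  ChordsIn : List Block → List Chord → Set
  ChordsIn bs = All (λ c → ∃ λ d → d ∈ S × Spans n (endpointˡ bs (proj₁ c)) (endpointˡ bs (proj₂ c)) (toℕ d))

  layout-fpm : ∀ (U : Subset n) bs cs → total bs ≡ n → WellFormed bs cs →
               1 < n → ⟦ n ⟧ 1 ∈ S → (∀ x → x ∈ S → neg n x ∈ S) → ChordsIn bs cs →
               (∀ w → w ∈ U → toℕ w ∈ₗ holes bs) → (∀ w → toℕ w ∈ₗ holes bs → w ∈ U) →
               FractionalPerfectMatching n S U
  layout-fpm U bs cs total≡n wf 1<n 1∈S S-symmetric chords U⊆holes holes⊆U =
    fpm-from-half-weights n S U (layoutWeight bs cs) (layoutWeight-sym bs cs) removed nonadjacent degree
    where
    ons : ChordsOnHalfPaths bs cs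
    ons = allChordsOnHalfPaths-sound bs cs (proj₁ (Equivalence.to T-∧ wf))

    removed : ∀ k (u : Fin n) → u ∈ U → layoutWeight bs cs k (toℕ u) ≡ 0
    removed k u u∈U with i , i<len , is-hole , u≡start ← ∈holes⇒hole bs (U⊆holes u u∈U) =
      trans (cong (layoutWeight bs cs k) u≡start) (layoutWeight-at-hole bs cs k ons i<len is-hole)

    AdjAt : ℕ → ℕ → Set
    AdjAt k j = ∀ (v u : Fin n) → toℕ v ≡ k → toℕ u ≡ j → Adj n S v u

    x+1 : ∀ x → x + toℕ (⟦ n ⟧ 1) ≡ suc x
    x+1 x = trans (cong (x +_) (toℕ-⟦⟧ 1<n)) (+-comm x 1)

    chordsAdj : ∀ cs → ChordsIn bs cs → ChordsWithin AdjAt bs cs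
    chordsAdj []       All.[]                           = All.[]
    chordsAdj (c ∷ cs) ((d , d∈S , spans) All.∷ chords) =
      ((λ v u v≡ u≡ → adjacent d∈S (spans-at v≡ u≡)) , (λ u v u≡ v≡ → adjacent-reverse (S-symmetric d d∈S) (spans-at v≡ u≡)))
      All.∷ chordsAdj cs chords
      where
      spans-at : ∀ {v u : Fin n} → toℕ v ≡ endpoint bs (proj₁ c) → toℕ u ≡ endpoint bs (proj₂ c) → Spans n (toℕ v) (toℕ u) (toℕ d)
      spans-at v≡ u≡ = subst₂ (λ x y → Spans n x y (toℕ d)) (sym (trans v≡ (endpoint≡endpointˡ bs (proj₁ c))))
                                                             (sym (trans u≡ (endpoint≡endpointˡ bs (proj₂ c)))) spans

    nonadjacent : ∀ v u → ¬ Adj n S v u → layoutWeight bs cs (toℕ v) (toℕ u) ≡ 0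
    nonadjacent v u ¬adj = layoutWeight-support bs cs AdjAt
      (λ x v u v≡x u≡x+1 → adjacent 1∈S (inj₁ (trans (x+1 (toℕ v)) (trans (cong suc v≡x) (sym u≡x+1)))))
      (λ x v u v≡x+1 u≡x → adjacent-reverse (S-symmetric _ 1∈S) (inj₁ (trans (x+1 (toℕ u)) (trans (cong suc u≡x) (sym v≡x+1)))))
      (chordsAdj cs chords) (λ adj → ¬adj (adj v u refl refl))

    degree : ∀ v → v ∉ U → ∑[ u < n ] layoutWeight bs cs (toℕ v) (toℕ u) ≡ 2
    degree v v∉U = layout-degree n bs cs (toℕ v) total≡n wf (toℕ<n v) (v∉U ∘ holes⊆U v)

-- Removing 0, s, a and a + 1

set4⁻ : ∀ {n} {w x₀ x₁ x₂ x₃ : Fin n} → w ∈ set4 x₀ x₁ x₂ x₃ → w ∈ₗ x₀ ∷ x₁ ∷ x₂ ∷ x₃ ∷ []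
set4⁻ {x₀ = x₀} {x₁} {x₂} {x₃} w∈ with x∈p∪q⁻ ⁅ x₀ ⁆ _ w∈
... | inj₁ w∈x₀ = here (x∈⁅y⁆⇒x≡y x₀ w∈x₀)
... | inj₂ w∈ with x∈p∪q⁻ ⁅ x₁ ⁆ _ w∈
...   | inj₁ w∈x₁ = there (here (x∈⁅y⁆⇒x≡y x₁ w∈x₁))
...   | inj₂ w∈ with x∈p∪q⁻ ⁅ x₂ ⁆ _ w∈
...     | inj₁ w∈x₂ = there (there (here (x∈⁅y⁆⇒x≡y x₂ w∈x₂)))
...     | inj₂ w∈x₃ = there (there (there (here (x∈⁅y⁆⇒x≡y x₃ w∈x₃))))

set4⁺ : ∀ {n} {w x₀ x₁ x₂ x₃ : Fin n} → w ∈ₗ x₀ ∷ x₁ ∷ x₂ ∷ x₃ ∷ [] → w ∈ set4 x₀ x₁ x₂ x₃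
set4⁺ {x₀ = x₀}          (here refl)                       = x∈p∪q⁺ (inj₁ (x∈⁅x⁆ x₀))
set4⁺ {x₀ = x₀} {x₁}     (there (here refl))               = x∈p∪q⁺ {p = ⁅ x₀ ⁆} (inj₂ (x∈p∪q⁺ (inj₁ (x∈⁅x⁆ x₁))))
set4⁺ {x₀ = x₀} {x₁} {x₂} (there (there (here refl)))      =
  x∈p∪q⁺ {p = ⁅ x₀ ⁆} (inj₂ (x∈p∪q⁺ {p = ⁅ x₁ ⁆} (inj₂ (x∈p∪q⁺ (inj₁ (x∈⁅x⁆ x₂))))))
set4⁺ {x₀ = x₀} {x₁} {x₂} {x₃} (there (there (there (here refl)))) =
  x∈p∪q⁺ {p = ⁅ x₀ ⁆} (inj₂ (x∈p∪q⁺ {p = ⁅ x₁ ⁆} (inj₂ (x∈p∪q⁺ {p = ⁅ x₂ ⁆} (inj₂ (x∈⁅x⁆ x₃))))))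

∈-map-toℕ⁻ : ∀ {n} {w : Fin n} {xs} → toℕ w ∈ₗ map toℕ xs → w ∈ₗ xs
∈-map-toℕ⁻ w∈ with x , x∈ , eq ← ∈-map⁻ toℕ w∈ = subst (_∈ₗ _) (sym (toℕ-injective eq)) x∈

module Removal (n : ℕ) .{{_ : NonZero n}} (S : Subset n) (s₁ a : Fin n)
               (1<n : 1 < n) (1∈S : ⟦ n ⟧ 1 ∈ S) (S-symmetric : ∀ x → x ∈ S → neg n x ∈ S) (s₁∈S : s₁ ∈ S)
               (toℕ-a+1 : toℕ (add n a (⟦ n ⟧ 1)) ≡ suc (toℕ a)) where

  open Circulant n S public

  Removed : Subset n
  Removed = set4 (⟦ n ⟧ 0) s₁ a (add n a (⟦ n ⟧ 1))

  removal-fpm : ∀ bs cs {iₛ iₐ} → n ≡ totalFrom 0 bs → WellFormed bs cs → ChordsIn bs cs →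
                holeIndices bs ↭ 0 ∷ iₛ ∷ iₐ ∷ suc iₐ ∷ [] → toℕ s₁ ≡ startFrom 0 bs iₛ → toℕ a ≡ startFrom 0 bs iₐ →
                FractionalPerfectMatching n S Removed
  removal-fpm bs cs {iₛ} {iₐ} n≡ wf chords perm s≡ a≡ =
    layout-fpm Removed bs cs (sym (trans n≡ (totalFrom-≡ 0 bs))) wf 1<n 1∈S S-symmetric chords
      (λ w → ↭.∈-resp-↭ positions ∘ ∈-map⁺ toℕ ∘ set4⁻)
      (λ w → set4⁺ ∘ ∈-map-toℕ⁻ ∘ ↭.∈-resp-↭ (↭-sym positions))
    where
    toℕ-0 : toℕ (⟦ n ⟧ 0) ≡ start bs 0
    toℕ-0 = trans (toℕ-⟦⟧ (<-trans (s≤s z≤n) 1<n)) (sym (start-zero bs))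
    a-is-hole : iₐ < length bs × T (isHole (block bs iₐ))
    a-is-hole with iₐ∈upTo , is-hole ← ∈-filter⁻ (λ i → T? (isHole (block bs i))) (↭.∈-resp-↭ (↭-sym perm) (there (there (here refl))))
      = ∈-upTo⁻ iₐ∈upTo , is-hole
    toℕ-a+1≡start : toℕ (add n a (⟦ n ⟧ 1)) ≡ start bs (suc iₐ)
    toℕ-a+1≡start = begin
      toℕ (add n a (⟦ n ⟧ 1))           ≡⟨ toℕ-a+1 ⟩
      suc (toℕ a)                       ≡⟨ cong suc (trans a≡ (startFrom-≡ 0 bs iₐ)) ⟩
      suc (start bs iₐ)                 ≡⟨ +-comm 1 (start bs iₐ) ⟩
      start bs iₐ + 1                   ≡⟨ cong (λ b → start bs iₐ + size b) (isHole⇒≡hole (proj₂ a-is-hole)) ⟨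
      start bs iₐ + size (block bs iₐ)  ≡⟨ start-suc bs (proj₁ a-is-hole) ⟨
      start bs (suc iₐ)                 ∎
      where open ≡-Reasoning
    positions : map toℕ (⟦ n ⟧ 0 ∷ s₁ ∷ a ∷ add n a (⟦ n ⟧ 1) ∷ []) ↭ holes bs
    positions = subst (_↭ holes bs)
      (cong₂ _∷_ (sym toℕ-0) (cong₂ _∷_ (sym (trans s≡ (startFrom-≡ 0 bs iₛ))) (cong₂ _∷_ (sym (trans a≡ (startFrom-≡ 0 bs iₐ)))
        (cong₂ _∷_ (sym toℕ-a+1≡start) refl))))
      (↭.map⁺ (start bs) (↭-sym perm))

  -- When a < s the holes come in the order 0, a, a + 1, s.
  below-by-shift : ∀ {i₁ i₂ i₃} → 0 ∷ i₁ ∷ i₂ ∷ i₃ ∷ [] ↭ 0 ∷ i₃ ∷ i₁ ∷ i₂ ∷ []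
  below-by-shift {i₁} {i₂} {i₃} = prep 0 (↭.shift i₃ (i₁ ∷ i₂ ∷ []) [])

  -- Each layout below lists the blocks of 0, …, n − 1 from the removed vertex 0 on. Its hypotheses give a, s
  -- and n as sums of the sizes of the blocks before them, and each chord is given by the positions of its two
  -- ends and by the element of S (s₁ or t) whose length it has.
  fpm-a-odd-below : ∀ p h₁ h₂ →
    let A = 1 + (p + p); S₁ = A + 1 + 1 + (1 + h₁) in
    toℕ a ≡ A → toℕ s₁ ≡ S₁ → n ≡ S₁ + 1 + ((p + 1) + (p + 1)) + (1 + h₂) → FractionalPerfectMatching n S Removed
  fpm-a-odd-below p h₁ h₂ a≡ s≡ n≡ =
    let A = 1 + (p + p)
        S₁ = A + 1 + 1 + (1 + h₁)
    in
    removal-fpm (hole ∷ pairs p ∷ hole ∷ hole ∷ halfPath h₁ ∷ hole ∷ pairs (p + 1) ∷ halfPath h₂ ∷ [])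
      (((7 , right) , (4 , right)) ∷ ((4 , left) , (7 , left)) ∷ []) n≡ _
      (wrapping-chord (S₁ + 1 + ((p + 1) + (p + 1)) + h₂) (A + 1 + 1 + h₁) s₁ s₁∈S s≡ n≡ (solve (p ∷ h₁ ∷ h₂ ∷ []))
       All.∷ chord (A + 1 + 1) (S₁ + 1 + ((p + 1) + (p + 1))) s₁ s₁∈S s≡ (solve (p ∷ h₁ ∷ h₂ ∷ [])) All.∷ All.[])
      below-by-shift s≡ a≡

  fpm-a-even-below : ∀ p h₁ h₂ →
    let A = 1 + (1 + p); S₁ = A + 1 + 1 + (1 + h₁) in
    toℕ a ≡ A → toℕ s₁ ≡ S₁ → n ≡ S₁ + 1 + (1 + p) + (1 + 1) + (1 + h₂) → FractionalPerfectMatching n S Removed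
  fpm-a-even-below p h₁ h₂ a≡ s≡ n≡ =
    let A = 1 + (1 + p)
        S₁ = A + 1 + 1 + (1 + h₁)
    in
    removal-fpm (hole ∷ halfPath p ∷ hole ∷ hole ∷ halfPath h₁ ∷ hole ∷ halfPath p ∷ pairs 1 ∷ halfPath h₂ ∷ [])
      (((1 , left) , (6 , left)) ∷ ((1 , right) , (6 , right)) ∷ ((8 , right) , (4 , right)) ∷ ((4 , left) , (8 , left)) ∷ []) n≡ _
      (chord 1 (S₁ + 1) s₁ s₁∈S s≡ (solve (p ∷ h₁ ∷ h₂ ∷ []))
       All.∷ chord (1 + p) (S₁ + 1 + p) s₁ s₁∈S s≡ (solve (p ∷ h₁ ∷ h₂ ∷ []))
       All.∷ wrapping-chord (S₁ + 1 + (1 + p) + (1 + 1) + h₂) (A + 1 + 1 + h₁) s₁ s₁∈S s≡ n≡ (solve (p ∷ h₁ ∷ h₂ ∷ []))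
       All.∷ chord (A + 1 + 1) (S₁ + 1 + (1 + p) + (1 + 1)) s₁ s₁∈S s≡ (solve (p ∷ h₁ ∷ h₂ ∷ [])) All.∷ All.[])
      below-by-shift s≡ a≡

  fpm-a≡s-2 : ∀ h₁ h₂ →
    let A = 1 + (1 + h₁); S₁ = A + 1 + 1 in
    toℕ a ≡ A → toℕ s₁ ≡ S₁ → n ≡ S₁ + 1 + (1 + h₂) + (1 + 1) → FractionalPerfectMatching n S Removed
  fpm-a≡s-2 h₁ h₂ a≡ s≡ n≡ =
    let A = 1 + (1 + h₁)
        S₁ = A + 1 + 1
    in
    removal-fpm (hole ∷ halfPath h₁ ∷ hole ∷ hole ∷ hole ∷ halfPath h₂ ∷ pairs 1 ∷ [])
      (((1 , left) , (5 , left)) ∷ ((5 , right) , (1 , right)) ∷ []) n≡ _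
      (chord 1 (S₁ + 1) s₁ s₁∈S s≡ (solve (h₁ ∷ h₂ ∷ []))
       All.∷ wrapping-chord (S₁ + 1 + h₂) (1 + h₁) s₁ s₁∈S s≡ n≡ (solve (h₁ ∷ h₂ ∷ [])) All.∷ All.[])
      below-by-shift s≡ a≡

  fpm-a≡s+1 : ∀ h₁ h₂ →
    let S₁ = 1 + (1 + 1) + (1 + h₁); A = S₁ + 1 in
    toℕ a ≡ A → toℕ s₁ ≡ S₁ → n ≡ A + 1 + 1 + (1 + h₂) → FractionalPerfectMatching n S Removed
  fpm-a≡s+1 h₁ h₂ a≡ s≡ n≡ =
    let S₁ = 1 + (1 + 1) + (1 + h₁)
        A = S₁ + 1
    in
    removal-fpm (hole ∷ pairs 1 ∷ halfPath h₁ ∷ hole ∷ hole ∷ hole ∷ halfPath h₂ ∷ [])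
      (((2 , left) , (6 , left)) ∷ ((6 , right) , (2 , right)) ∷ []) n≡ _
      (chord (1 + (1 + 1)) (A + 1 + 1) s₁ s₁∈S s≡ (solve (h₁ ∷ h₂ ∷ []))
       All.∷ wrapping-chord (A + 1 + 1 + h₂) (1 + (1 + 1) + h₁) s₁ s₁∈S s≡ n≡ (solve (h₁ ∷ h₂ ∷ [])) All.∷ All.[])
      ↭-refl s≡ a≡

  fpm-a≡n-2 : ∀ h₁ h₂ →
    let S₁ = 1 + (1 + h₁) + (1 + 1); A = S₁ + 1 + (1 + h₂) in
    toℕ a ≡ A → toℕ s₁ ≡ S₁ → n ≡ A + 1 + 1 → FractionalPerfectMatching n S Removed
  fpm-a≡n-2 h₁ h₂ a≡ s≡ n≡ =
    let S₁ = 1 + (1 + h₁) + (1 + 1)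
        A = S₁ + 1 + (1 + h₂)
    in
    removal-fpm (hole ∷ halfPath h₁ ∷ pairs 1 ∷ hole ∷ halfPath h₂ ∷ hole ∷ hole ∷ [])
      (((1 , left) , (4 , left)) ∷ ((4 , right) , (1 , right)) ∷ []) n≡ _
      (chord 1 (S₁ + 1) s₁ s₁∈S s≡ (solve (h₁ ∷ h₂ ∷ []))
       All.∷ wrapping-chord (S₁ + 1 + h₂) (1 + h₁) s₁ s₁∈S s≡ n≡ (solve (h₁ ∷ h₂ ∷ [])) All.∷ All.[])
      ↭-refl s≡ a≡

  fpm-a-above : ∀ m₃ m₄ l₂ l₃ →
    let H = 2 * m₃ + 2 * m₄ + 1; S₁ = 1 + (1 + H); A = S₁ + 1 + (1 + l₂) + (m₃ + m₃) in
    toℕ a ≡ A → toℕ s₁ ≡ S₁ → n ≡ A + 1 + 1 + (m₄ + m₄) + (1 + l₃) → FractionalPerfectMatching n S Removed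
  fpm-a-above m₃ m₄ l₂ l₃ a≡ s≡ n≡ =
    let H = 2 * m₃ + 2 * m₄ + 1
        S₁ = 1 + (1 + H)
        A = S₁ + 1 + (1 + l₂) + (m₃ + m₃)
    in
    removal-fpm (hole ∷ halfPath H ∷ hole ∷ halfPath l₂ ∷ pairs m₃ ∷ hole ∷ hole ∷ pairs m₄ ∷ halfPath l₃ ∷ [])
      (((8 , right) , (1 , right)) ∷ ((1 , left) , (3 , left)) ∷ ((3 , right) , (8 , left)) ∷ []) n≡ _
      (wrapping-chord (A + 1 + 1 + (m₄ + m₄) + l₃) (1 + H) s₁ s₁∈S s≡ n≡ (solve (m₃ ∷ m₄ ∷ l₂ ∷ l₃ ∷ []))
       All.∷ chord 1 (S₁ + 1) s₁ s₁∈S s≡ (solve (m₃ ∷ m₄ ∷ l₂ ∷ l₃ ∷ []))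
       All.∷ chord (S₁ + 1 + l₂) (A + 1 + 1 + (m₄ + m₄)) s₁ s₁∈S s≡ (solve (m₃ ∷ m₄ ∷ l₂ ∷ l₃ ∷ [])) All.∷ All.[])
      ↭-refl s≡ a≡

  fpm-a≡s+2-tight : ∀ h →
    let S₁ = 1 + (1 + 0) + (1 + 1) + (1 + h); A = S₁ + 1 + (1 + 0) in
    toℕ a ≡ A → toℕ s₁ ≡ S₁ → n ≡ A + 1 + 1 + (1 + (h + 1)) → FractionalPerfectMatching n S Removed
  fpm-a≡s+2-tight h a≡ s≡ n≡ =
    let S₁ = 1 + (1 + 0) + (1 + 1) + (1 + h)
        A = S₁ + 1 + (1 + 0)
    in
    removal-fpm (hole ∷ halfPath 0 ∷ pairs 1 ∷ halfPath h ∷ hole ∷ halfPath 0 ∷ hole ∷ hole ∷ halfPath (h + 1) ∷ [])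
      (((1 , left) , (5 , left)) ∷ ((1 , right) , (5 , right)) ∷ ((3 , left) , (8 , left)) ∷ ((8 , right) , (3 , right)) ∷ []) n≡ _
      (chord 1 (S₁ + 1) s₁ s₁∈S s≡ (solve (h ∷ []))
       All.∷ chord (1 + 0) (S₁ + 1 + 0) s₁ s₁∈S s≡ (solve (h ∷ []))
       All.∷ chord (1 + (1 + 0) + (1 + 1)) (A + 1 + 1) s₁ s₁∈S s≡ (solve (h ∷ []))
       All.∷ wrapping-chord (A + 1 + 1 + (h + 1)) (1 + (1 + 0) + (1 + 1) + h) s₁ s₁∈S s≡ n≡ (solve (h ∷ [])) All.∷ All.[])
      ↭-refl s≡ a≡

  fpm-a≡n-3-tight : ∀ h →
    let S₁ = 1 + (1 + h) + (1 + 1) + (1 + 0); A = S₁ + 1 + (1 + (h + 1)) in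
    toℕ a ≡ A → toℕ s₁ ≡ S₁ → n ≡ A + 1 + 1 + (1 + 0) → FractionalPerfectMatching n S Removed
  fpm-a≡n-3-tight h a≡ s≡ n≡ =
    let S₁ = 1 + (1 + h) + (1 + 1) + (1 + 0)
        A = S₁ + 1 + (1 + (h + 1))
    in
    removal-fpm (hole ∷ halfPath h ∷ pairs 1 ∷ halfPath 0 ∷ hole ∷ halfPath (h + 1) ∷ hole ∷ hole ∷ halfPath 0 ∷ [])
      (((1 , left) , (5 , left)) ∷ ((5 , right) , (1 , right)) ∷ ((8 , left) , (3 , left)) ∷ ((8 , right) , (3 , right)) ∷ []) n≡ _
      (chord 1 (S₁ + 1) s₁ s₁∈S s≡ (solve (h ∷ []))
       All.∷ wrapping-chord (S₁ + 1 + (h + 1)) (1 + h) s₁ s₁∈S s≡ n≡ (solve (h ∷ []))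
       All.∷ wrapping-chord (A + 1 + 1) (1 + (1 + h) + (1 + 1)) s₁ s₁∈S s≡ n≡ (solve (h ∷ []))
       All.∷ wrapping-chord (A + 1 + 1 + 0) (1 + (1 + h) + (1 + 1) + 0) s₁ s₁∈S s≡ n≡ (solve (h ∷ [])) All.∷ All.[])
      ↭-refl s≡ a≡

  fpm-odd-gap-tight : ∀ p r →
    let S₁ = 1 + (1 + (2 * p + 1)) + ((r + 2) + (r + 2)); A = S₁ + 1 + (1 + (2 * p + 2)) in
    toℕ a ≡ A → toℕ s₁ ≡ S₁ → n ≡ A + 1 + 1 + ((r + 1) + (r + 1)) → FractionalPerfectMatching n S Removed
  fpm-odd-gap-tight p r a≡ s≡ n≡ =
    let S₁ = 1 + (1 + (2 * p + 1)) + ((r + 2) + (r + 2))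
        A = S₁ + 1 + (1 + (2 * p + 2))
    in
    removal-fpm (hole ∷ halfPath (2 * p + 1) ∷ pairs (r + 2) ∷ hole ∷ halfPath (2 * p + 2) ∷ hole ∷ hole ∷ pairs (r + 1) ∷ [])
      (((1 , left) , (4 , left)) ∷ ((4 , right) , (1 , right)) ∷ []) n≡ _
      (chord 1 (S₁ + 1) s₁ s₁∈S s≡ (solve (p ∷ r ∷ []))
       All.∷ wrapping-chord (S₁ + 1 + (2 * p + 2)) (1 + (2 * p + 1)) s₁ s₁∈S s≡ n≡ (solve (p ∷ r ∷ [])) All.∷ All.[])
      ↭-refl s≡ a≡

  fpm-even-gap-tight : ∀ p r →
    let S₁ = 1 + ((p + 2) + (p + 2)) + (1 + (2 * r + 1)); A = S₁ + 1 + ((p + 1) + (p + 1)) in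
    toℕ a ≡ A → toℕ s₁ ≡ S₁ → n ≡ A + 1 + 1 + (1 + (2 * r + 2)) → FractionalPerfectMatching n S Removed
  fpm-even-gap-tight p r a≡ s≡ n≡ =
    let S₁ = 1 + ((p + 2) + (p + 2)) + (1 + (2 * r + 1))
        A = S₁ + 1 + ((p + 1) + (p + 1))
    in
    removal-fpm (hole ∷ pairs (p + 2) ∷ halfPath (2 * r + 1) ∷ hole ∷ pairs (p + 1) ∷ hole ∷ hole ∷ halfPath (2 * r + 2) ∷ [])
      (((2 , left) , (7 , left)) ∷ ((7 , right) , (2 , right)) ∷ []) n≡ _
      (chord (1 + ((p + 2) + (p + 2))) (A + 1 + 1) s₁ s₁∈S s≡ (solve (p ∷ r ∷ []))
       All.∷ wrapping-chord (A + 1 + 1 + (2 * r + 2)) (1 + ((p + 2) + (p + 2)) + (2 * r + 1)) s₁ s₁∈S s≡ n≡ (solve (p ∷ r ∷ []))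
       All.∷ All.[])
      ↭-refl s≡ a≡

  module _ (t : Fin n) (t∈S : t ∈ S) (s≡3 : toℕ s₁ ≡ 3) where

    fpm-a≡1-even-t : ∀ u m → toℕ t ≡ 2 * u + 2 → toℕ a ≡ 1 → n ≡ 4 + (1 + (2 * u + 2)) + (m + m) →
                     FractionalPerfectMatching n S Removed
    fpm-a≡1-even-t u m t≡ a≡ n≡ = removal-fpm
      (hole ∷ hole ∷ hole ∷ hole ∷ halfPath (2 * u + 2) ∷ pairs m ∷ [])
      (((4 , left) , (4 , right)) ∷ []) n≡ _
      (chord 4 (4 + (2 * u + 2)) t t∈S t≡ (solve (u ∷ m ∷ [])) All.∷ All.[])
      below-by-shift s≡3 a≡

    fpm-a≡1-odd-t : ∀ u h → toℕ t ≡ 2 * u + 5 → toℕ a ≡ 1 → n ≡ 4 + (1 + 2 * u) + (2 + 2) + (1 + h) →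
                    FractionalPerfectMatching n S Removed
    fpm-a≡1-odd-t u h t≡ a≡ n≡ = removal-fpm
      (hole ∷ hole ∷ hole ∷ hole ∷ halfPath (2 * u) ∷ pairs 2 ∷ halfPath h ∷ [])
      (((6 , right) , (4 , right)) ∷ ((4 , left) , (6 , left)) ∷ []) n≡ _
      (wrapping-chord (4 + (1 + 2 * u) + (2 + 2) + h) (4 + 2 * u) t t∈S t≡ n≡ (solve (u ∷ h ∷ []))
       All.∷ chord 4 (4 + (1 + 2 * u) + (2 + 2)) t t∈S t≡ (solve (u ∷ h ∷ [])) All.∷ All.[])
      below-by-shift s≡3 a≡

    fpm-a≡4-even-t : ∀ u m → toℕ t ≡ 2 * u + 2 → toℕ a ≡ 4 → n ≡ 6 + (m + m) + (1 + 2 * u) →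
                     FractionalPerfectMatching n S Removed
    fpm-a≡4-even-t u m t≡ a≡ n≡ = removal-fpm
      (hole ∷ halfPath 1 ∷ hole ∷ hole ∷ hole ∷ pairs m ∷ halfPath (2 * u) ∷ [])
      (((6 , right) , (1 , right)) ∷ ((6 , left) , (1 , left)) ∷ []) n≡ _
      (wrapping-chord (6 + (m + m) + 2 * u) (1 + 1) s₁ s₁∈S s≡3 n≡ (solve (u ∷ m ∷ []))
       All.∷ wrapping-chord (6 + (m + m)) 1 t t∈S t≡ n≡ (solve (u ∷ m ∷ [])) All.∷ All.[])
      ↭-refl s≡3 a≡

    fpm-a≡4-odd-t : ∀ u h → toℕ t ≡ 2 * u + 5 → toℕ a ≡ 4 → n ≡ 6 + (u + u) + (1 + h) →
                    FractionalPerfectMatching n S Removed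
    fpm-a≡4-odd-t u h t≡ a≡ n≡ = removal-fpm
      (hole ∷ halfPath 1 ∷ hole ∷ hole ∷ hole ∷ pairs u ∷ halfPath h ∷ [])
      (((6 , right) , (1 , right)) ∷ ((1 , left) , (6 , left)) ∷ []) n≡ _
      (wrapping-chord (6 + (u + u) + h) (1 + 1) s₁ s₁∈S s≡3 n≡ (solve (u ∷ h ∷ []))
       All.∷ chord 1 (6 + (u + u)) t t∈S t≡ (solve (u ∷ h ∷ [])) All.∷ All.[])
      ↭-refl s≡3 a≡

    fpm-a≡n-2-even-t : ∀ u m → toℕ t ≡ 2 * u + 2 → toℕ a ≡ 4 + (1 + 2 * u) + (m + m) → n ≡ 4 + (1 + 2 * u) + (m + m) + 1 + 1 →
                       FractionalPerfectMatching n S Removed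
    fpm-a≡n-2-even-t u m t≡ a≡ n≡ = removal-fpm
      (hole ∷ halfPath 1 ∷ hole ∷ halfPath (2 * u) ∷ pairs m ∷ hole ∷ hole ∷ [])
      (((1 , left) , (3 , left)) ∷ ((1 , right) , (3 , right)) ∷ []) n≡ _
      (chord 1 4 s₁ s₁∈S s≡3 refl All.∷ chord (1 + 1) (4 + 2 * u) t t∈S t≡ (solve (u ∷ m ∷ [])) All.∷ All.[])
      ↭-refl s≡3 a≡

    fpm-a≡n-2-odd-t : ∀ u h → toℕ t ≡ 2 * u + 5 → toℕ a ≡ 4 + (1 + h) + (u + u) → n ≡ 4 + (1 + h) + (u + u) + 1 + 1 →
                      FractionalPerfectMatching n S Removed
    fpm-a≡n-2-odd-t u h t≡ a≡ n≡ = removal-fpm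
      (hole ∷ halfPath 1 ∷ hole ∷ halfPath h ∷ pairs u ∷ hole ∷ hole ∷ [])
      (((1 , left) , (3 , left)) ∷ ((3 , right) , (1 , right)) ∷ []) n≡ _
      (chord 1 4 s₁ s₁∈S s≡3 refl All.∷ wrapping-chord (4 + h) (1 + 1) t t∈S t≡ n≡ (solve (u ∷ h ∷ [])) All.∷ All.[])
      ↭-refl s≡3 a≡

-- A second chord length

ExtraChord : (n : ℕ) → Subset n → Set
ExtraChord n S = Σ[ t ∈ Fin n ] t ∈ S × 2 ≤ toℕ t × toℕ t ≢ 3 × 2 * toℕ t < n

∣p∪q∣≤∣p∣+∣q∣ : ∀ {m} (p q : Subset m) → ∣ p ∪ q ∣ ≤ ∣ p ∣ + ∣ q ∣
∣p∪q∣≤∣p∣+∣q∣ Vec.[]            Vec.[]            = z≤n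
∣p∪q∣≤∣p∣+∣q∣ (inside  Vec.∷ p) (y Vec.∷ q)       = s≤s (≤-trans (∣p∪q∣≤∣p∣+∣q∣ p q) (+-monoʳ-≤ ∣ p ∣ (∣p∣≤∣x∷p∣ y q)))
∣p∪q∣≤∣p∣+∣q∣ (outside Vec.∷ p) (inside Vec.∷ q)  = subst (suc ∣ p ∪ q ∣ ≤_) (sym (+-suc ∣ p ∣ ∣ q ∣)) (s≤s (∣p∪q∣≤∣p∣+∣q∣ p q))
∣p∪q∣≤∣p∣+∣q∣ (outside Vec.∷ p) (outside Vec.∷ q) = ∣p∪q∣≤∣p∣+∣q∣ p q

fromList : ∀ {m} → List (Fin m) → Subset m
fromList = foldr (λ x p → ⁅ x ⁆ ∪ p) ⊥

∣fromList∣≤length : ∀ {m} (xs : List (Fin m)) → ∣ fromList xs ∣ ≤ length xs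
∣fromList∣≤length {m} []       = ≤-reflexive (∣⊥∣≡0 m)
∣fromList∣≤length      (x ∷ xs) = ≤-trans (∣p∪q∣≤∣p∣+∣q∣ ⁅ x ⁆ (fromList xs))
                                          (subst (_≤ suc (length xs)) (cong (_+ ∣ fromList xs ∣) (sym (∣⁅x⁆∣≡1 x)))
                                                 (s≤s (∣fromList∣≤length xs)))

∈fromList : ∀ {m} {x : Fin m} {xs} → x ∈ₗ xs → x ∈ fromList xs
∈fromList {x = x} {y ∷ xs} (here refl) = x∈p∪q⁺ (inj₁ (x∈⁅x⁆ x))
∈fromList {xs = y ∷ xs}    (there x∈)  = x∈p∪q⁺ {p = ⁅ y ⁆} (inj₂ (∈fromList x∈))

outside-list : ∀ {m} (S : Subset m) (xs : List (Fin m)) → length xs < ∣ S ∣ → ∃ λ x → x ∈ S × x ∉ₗ xs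
outside-list S xs xs<S with any? (λ x → (x ∈? S) ×-dec ¬? (Any.any? (x Fin.≟_) xs))
... | yes found = found
... | no none   = contradiction (p⊆q⇒∣p∣≤∣q∣ S⊆xs) (<⇒≱ (<-≤-trans xs<S′ ≤-refl))
  where
  S⊆xs : S ⊆ fromList xs
  S⊆xs {x} x∈S = ∈fromList (decidable-stable (Any.any? (x Fin.≟_) xs) (λ x∉xs → none (x , x∈S , x∉xs)))
  xs<S′ : ∣ fromList xs ∣ < ∣ S ∣
  xs<S′ = ≤-<-trans (∣fromList∣≤length xs) xs<S

2≤-from : ∀ {m} → m ≢ 0 → m ≢ 1 → 2 ≤ m
2≤-from {zero}          m≢0 _   = contradiction refl m≢0
2≤-from {suc zero}      _   m≢1 = contradiction refl m≢1
2≤-from {suc (suc _)}   _   _   = s≤s (s≤s z≤n)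

-- Only 0, ±1 and ±3 are excluded, so |S| ≥ 6 leaves some x ∈ S; if 2x > n, its negative n − x is taken.
extra-chord : ∀ n .{{_ : NonZero n}} (S : Subset n) k → n ≡ 2 * k + 1 → 7 ≤ n → (∀ x → x ∈ S → neg n x ∈ S) → 6 ≤ ∣ S ∣ →
              ExtraChord n S
extra-chord n S k n≡ 7≤n S-symmetric 6≤∣S∣ = representative (outside-list S excluded 6≤∣S∣)
  where
  excluded : List (Fin n)
  excluded = ⟦ n ⟧ 0 ∷ ⟦ n ⟧ 1 ∷ ⟦ n ⟧ 3 ∷ ⟦ n ⟧ (n ∸ 3) ∷ ⟦ n ⟧ (n ∸ 1) ∷ []

  n≡1+2k : n ≡ suc (2 * k)
  n≡1+2k = trans n≡ (+-comm (2 * k) 1)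

  n∸<n : ∀ c → n ∸ suc c < n
  n∸<n c = subst (λ m → m ∸ suc c < m) (sym n≡1+2k) (s≤s (m∸n≤m (2 * k) c))

  representative : (∃ λ x → x ∈ S × x ∉ₗ excluded) → ExtraChord n S
  representative (x , x∈S , x∉) = by-size (2 * v <? n)
    where
    v : ℕ
    v = toℕ x
    v+[n∸v]≡n : v + (n ∸ v) ≡ n
    v+[n∸v]≡n = m+[n∸m]≡n (<⇒≤ (toℕ<n x))
    v≢ : ∀ {c} → c < n → (∀ {y} → y ≡ ⟦ n ⟧ c → y ∈ₗ excluded) → v ≢ c
    v≢ c<n at-c v≡c = x∉ (at-c (toℕ-injective (trans v≡c (sym (toℕ-⟦⟧ c<n)))))
    v≢0 : v ≢ 0
    v≢0 = v≢ (<-≤-trans (s≤s z≤n) 7≤n) here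
    v≢1 : v ≢ 1
    v≢1 = v≢ (<-≤-trans (s≤s (s≤s z≤n)) 7≤n) (there ∘ here)
    v≡n∸ : ∀ c → n ∸ v ≡ c → v ≡ n ∸ c
    v≡n∸ c n∸v≡c = trans (sym (m+n∸n≡m v c)) (cong (_∸ c) (trans (cong (v +_) (sym n∸v≡c)) v+[n∸v]≡n))
    toℕ-neg : toℕ (neg n x) ≡ n ∸ v
    toℕ-neg = trans (toℕ-fromℕ< _) (m<n⇒m%n≡m (subst (n ∸ v <_) v+[n∸v]≡n (m<n+m (n ∸ v) (n≢0⇒n>0 v≢0))))
    by-size : Dec (2 * v < n) → ExtraChord n S
    by-size (yes 2v<n) = x , x∈S , 2≤-from v≢0 v≢1 , v≢ (<-≤-trans (s≤s (s≤s (s≤s (s≤s z≤n)))) 7≤n) (there ∘ there ∘ here) , 2v<n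
    by-size (no 2v≮n)  = neg n x , S-symmetric x x∈S ,
      subst (2 ≤_) (sym toℕ-neg) (2≤-from (λ n∸v≡0 → <-irrefl (v≡n∸ 0 n∸v≡0) (toℕ<n x))
                                          (λ n∸v≡1 → v≢ (n∸<n 0) (there ∘ there ∘ there ∘ there ∘ here) (v≡n∸ 1 n∸v≡1))) ,
      (λ eq → v≢ (n∸<n 2) (there ∘ there ∘ there ∘ here) (v≡n∸ 3 (trans (sym toℕ-neg) eq))) ,
      subst (λ m → 2 * m < n) (sym toℕ-neg) (+-cancelˡ-< n (2 * (n ∸ v)) n (begin-strict
        n + 2 * (n ∸ v)     <⟨ +-monoˡ-< (2 * (n ∸ v)) n<2v ⟩
        2 * v + 2 * (n ∸ v) ≡⟨ *-distribˡ-+ 2 v (n ∸ v) ⟨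
        2 * (v + (n ∸ v))   ≡⟨ cong (2 *_) v+[n∸v]≡n ⟩
        2 * n               ≡⟨ cong (n +_) (+-identityʳ n) ⟩
        n + n               ∎))
      where
      open ≤-Reasoning hiding (start)
      n<2v : n < 2 * v
      n<2v = ≤∧≢⇒< (≮⇒≥ 2v≮n) (λ n≡2v → even≢odd v k (trans (sym n≡2v) n≡1+2k))

parity : ∀ m → ∃ λ k → m ≡ 2 * k ⊎ m ≡ 2 * k + 1
parity zero    = 0 , inj₁ refl
parity (suc m) with parity m
... | k , inj₁ m≡2k   = k , inj₂ (trans (cong suc m≡2k) (+-comm 1 (2 * k)))
... | k , inj₂ m≡2k+1 = suc k , inj₁ (trans (cong suc m≡2k+1) (solve (k ∷ [])))

half-≤ : ∀ {x y} → 2 * x ≤ y + 1 → x ≤ y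
half-≤ {zero}      _      = z≤n
half-≤ {suc x} {y} 2x≤y+1 = ≤-pred (begin
  suc (suc x)     ≤⟨ s≤s (m≤n+m (suc x) x) ⟩
  suc (x + suc x) ≡⟨ solve (x ∷ []) ⟩
  2 * suc x       ≤⟨ 2x≤y+1 ⟩
  y + 1           ≡⟨ +-comm y 1 ⟩
  suc y           ∎)
  where open ≤-Reasoning hiding (start)

half-≤-odd : ∀ x y → 2 * x ≤ 2 * y + 1 → x ≤ y
half-≤-odd x y 2x≤2y+1 = ≤-pred (*-cancelˡ-< 2 x (suc y) (begin-strict
  2 * x           <⟨ s≤s 2x≤2y+1 ⟩
  suc (2 * y + 1) ≡⟨ solve (y ∷ []) ⟩
  2 * suc y       ∎))
  where open ≤-Reasoning hiding (start)

module Construction (n : ℕ) .{{_ : NonZero n}} (S : Subset n) (s₁ a : Fin n)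
                    (1<n : 1 < n) (1∈S : ⟦ n ⟧ 1 ∈ S) (S-symmetric : ∀ x → x ∈ S → neg n x ∈ S) (s₁∈S : s₁ ∈ S)
                    (toℕ-a+1 : toℕ (add n a (⟦ n ⟧ 1)) ≡ suc (toℕ a)) where

  open Removal n S s₁ a 1<n 1∈S S-symmetric s₁∈S toℕ-a+1

  data ExtraChordShape (t : Fin n) : Set where
    even-t : ∀ u m → toℕ t ≡ 2 * u + 2 → n ≡ (2 * u + 2) + 5 + 2 * m → ExtraChordShape t
    odd-t  : ∀ u h → toℕ t ≡ 2 * u + 5 → n ≡ (2 * u + 5) + 5 + h → ExtraChordShape t

  even-extraChordShape : ∀ ν u (t : Fin n) → n ≡ 2 * ν + 7 → 2 * toℕ t < n → toℕ t ≡ 2 * u + 2 → ExtraChordShape t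
  even-extraChordShape ν u t n≡ 2t<n t≡ = shape (m≤n⇒∃[o]m+o≡n (half-≤ {u} {ν} (*-cancelˡ-≤ 2 (+-cancelʳ-≤ 5 _ _ 4u+5≤2ν+7))))
    where
    4u+5≤2ν+7 : 2 * (2 * u) + 5 ≤ 2 * (ν + 1) + 5
    4u+5≤2ν+7 = begin
      2 * (2 * u) + 5       ≡⟨ solve (u ∷ []) ⟩
      suc (2 * (2 * u + 2)) ≡⟨ cong (λ x → suc (2 * x)) t≡ ⟨
      suc (2 * toℕ t)       ≤⟨ 2t<n ⟩
      n                     ≡⟨ n≡ ⟩
      2 * ν + 7             ≡⟨ solve (ν ∷ []) ⟩
      2 * (ν + 1) + 5       ∎
      where open ≤-Reasoning hiding (start)
    shape : ∃ (λ m → u + m ≡ ν) → ExtraChordShape t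
    shape (m , u+m≡ν) = even-t u m t≡ (begin
      n                         ≡⟨ n≡ ⟩
      2 * ν + 7                 ≡⟨ cong (λ x → 2 * x + 7) u+m≡ν ⟨
      2 * (u + m) + 7           ≡⟨ solve (u ∷ m ∷ []) ⟩
      (2 * u + 2) + 5 + 2 * m   ∎)
      where open ≡-Reasoning

  odd-extraChordShape : ∀ ν u (t : Fin n) → n ≡ 2 * ν + 7 → 2 * toℕ t < n → toℕ t ≡ 2 * u + 5 → ExtraChordShape t
  odd-extraChordShape ν u t n≡ 2t<n t≡ = shape (m≤n⇒∃[o]m+o≡n (*-cancelˡ-≤ 2 (+-cancelʳ-≤ 7 _ _ 4u+11≤2ν+7)))
    where
    4u+11≤2ν+7 : 2 * (2 * u + 2) + 7 ≤ 2 * ν + 7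
    4u+11≤2ν+7 = begin
      2 * (2 * u + 2) + 7   ≡⟨ solve (u ∷ []) ⟩
      suc (2 * (2 * u + 5)) ≡⟨ cong (λ x → suc (2 * x)) t≡ ⟨
      suc (2 * toℕ t)       ≤⟨ 2t<n ⟩
      n                     ≡⟨ n≡ ⟩
      2 * ν + 7             ∎
      where open ≤-Reasoning hiding (start)
    shape : ∃ (λ o → 2 * u + 2 + o ≡ ν) → ExtraChordShape t
    shape (o , 2u+2+o≡ν) = odd-t u (2 * u + 2 * o + 1) t≡ (begin
      n                                      ≡⟨ n≡ ⟩
      2 * ν + 7                              ≡⟨ cong (λ x → 2 * x + 7) 2u+2+o≡ν ⟨
      2 * (2 * u + 2 + o) + 7                ≡⟨ solve (u ∷ o ∷ []) ⟩
      (2 * u + 5) + 5 + (2 * u + 2 * o + 1)  ∎)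
      where open ≡-Reasoning

  extraChordShape : ∀ ν (t : Fin n) → n ≡ 2 * ν + 7 → 2 ≤ toℕ t → toℕ t ≢ 3 → 2 * toℕ t < n → ExtraChordShape t
  extraChordShape ν t n≡ 2≤t t≢3 2t<n with parity (toℕ t)
  ... | zero        , inj₁ t≡0 = contradiction (subst (2 ≤_) t≡0 2≤t) λ ()
  ... | suc u       , inj₁ t≡  = even-extraChordShape ν u t n≡ 2t<n (trans t≡ (solve (u ∷ [])))
  ... | zero        , inj₂ t≡1 = contradiction (subst (2 ≤_) t≡1 2≤t) λ { (s≤s ()) }
  ... | suc zero    , inj₂ t≡3 = contradiction t≡3 t≢3
  ... | suc (suc u) , inj₂ t≡  = odd-extraChordShape ν u t n≡ 2t<n (trans t≡ (solve (u ∷ [])))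

  fpm-s≡3 : ∀ ν → toℕ s₁ ≡ 3 → n ≡ 2 * ν + 7 → ExtraChord n S → toℕ a ≡ 1 ⊎ toℕ a ≡ 4 ⊎ toℕ a + 2 ≡ n →
            FractionalPerfectMatching n S Removed
  fpm-s≡3 ν s≡3 n≡ (t , t∈S , 2≤t , t≢3 , 2t<n) a-at with extraChordShape ν t n≡ 2≤t t≢3 2t<n | a-at
  ... | even-t u m t≡ n≡′ | inj₁ a≡1        = fpm-a≡1-even-t t t∈S s≡3 u m t≡ a≡1 (trans n≡′ (solve (u ∷ m ∷ [])))
  ... | odd-t u h t≡ n≡′  | inj₁ a≡1        = fpm-a≡1-odd-t t t∈S s≡3 u h t≡ a≡1 (trans n≡′ (solve (u ∷ h ∷ [])))
  ... | even-t u m t≡ n≡′ | inj₂ (inj₁ a≡4) = fpm-a≡4-even-t t t∈S s≡3 u m t≡ a≡4 (trans n≡′ (solve (u ∷ m ∷ [])))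
  ... | odd-t u h t≡ n≡′  | inj₂ (inj₁ a≡4) = fpm-a≡4-odd-t t t∈S s≡3 u (h + 3) t≡ a≡4 (trans n≡′ (solve (u ∷ h ∷ [])))
  ... | even-t u m t≡ n≡′ | inj₂ (inj₂ a+2≡n) =
    fpm-a≡n-2-even-t t t∈S s≡3 u m t≡
      (trans (+-cancelʳ-≡ 2 (toℕ a) (2 * u + 2 * m + 5) (trans a+2≡n (trans n≡′ (solve (u ∷ m ∷ []))))) (solve (u ∷ m ∷ [])))
      (trans n≡′ (solve (u ∷ m ∷ [])))
  ... | odd-t u h t≡ n≡′  | inj₂ (inj₂ a+2≡n) =
    fpm-a≡n-2-odd-t t t∈S s≡3 u (h + 3) t≡
      (trans (+-cancelʳ-≡ 2 (toℕ a) (2 * u + h + 8) (trans a+2≡n (trans n≡′ (solve (u ∷ h ∷ []))))) (solve (u ∷ h ∷ [])))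
      (trans n≡′ (solve (u ∷ h ∷ [])))

  fpm-a≡s-2-any : ∀ σ ν → toℕ s₁ ≡ 2 * σ + 3 → n ≡ 4 * σ + 2 * ν + 7 → toℕ a ≡ 2 * σ + 1 → (σ ≡ 0 → ExtraChord n S) →
                  FractionalPerfectMatching n S Removed
  fpm-a≡s-2-any zero    ν s≡ n≡ a≡ extra = fpm-s≡3 ν s≡ n≡ (extra refl) (inj₁ a≡)
  fpm-a≡s-2-any (suc σ) ν s≡ n≡ a≡ _     =
    fpm-a≡s-2 (2 * σ + 1) (2 * σ + 2 + 2 * ν) (trans a≡ (solve (σ ∷ []))) (trans s≡ (solve (σ ∷ []))) (trans n≡ (solve (σ ∷ ν ∷ [])))

  fpm-a≡s+1-any : ∀ σ ν → toℕ s₁ ≡ 2 * σ + 3 → n ≡ 4 * σ + 2 * ν + 7 → toℕ a ≡ 2 * σ + 4 → (σ ≡ 0 → ExtraChord n S) →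
                  FractionalPerfectMatching n S Removed
  fpm-a≡s+1-any zero    ν s≡ n≡ a≡ extra = fpm-s≡3 ν s≡ n≡ (extra refl) (inj₂ (inj₁ a≡))
  fpm-a≡s+1-any (suc σ) ν s≡ n≡ a≡ _     =
    fpm-a≡s+1 (2 * σ + 1) (2 * σ + 2 + 2 * ν) (trans a≡ (solve (σ ∷ []))) (trans s≡ (solve (σ ∷ []))) (trans n≡ (solve (σ ∷ ν ∷ [])))

  fpm-a≡n-2-any : ∀ σ ν → toℕ s₁ ≡ 2 * σ + 3 → n ≡ 4 * σ + 2 * ν + 7 → toℕ a + 2 ≡ n → (σ ≡ 0 → ExtraChord n S) →
                  FractionalPerfectMatching n S Removed
  fpm-a≡n-2-any zero    ν s≡ n≡ a+2≡n extra = fpm-s≡3 ν s≡ n≡ (extra refl) (inj₂ (inj₂ a+2≡n))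
  fpm-a≡n-2-any (suc σ) ν s≡ n≡ a+2≡n _     =
    fpm-a≡n-2 (2 * σ + 1) (2 * σ + 2 + 2 * ν)
              (trans a≡ (solve (σ ∷ ν ∷ []))) (trans s≡ (solve (σ ∷ []))) (trans n≡ (solve (σ ∷ ν ∷ [])))
    where
    a≡ : toℕ a ≡ 4 * σ + 2 * ν + 9
    a≡ = +-cancelʳ-≡ 2 (toℕ a) (4 * σ + 2 * ν + 9) (trans a+2≡n (trans n≡ (solve (σ ∷ ν ∷ []))))

  fpm-a-below-s : ∀ σ ν A → toℕ s₁ ≡ 2 * σ + 3 → n ≡ 4 * σ + 2 * ν + 7 → toℕ a ≡ A → 0 < A → A ≤ 2 * σ + 1 →
                  (σ ≡ 0 → ExtraChord n S) → FractionalPerfectMatching n S Removed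
  fpm-a-below-s σ ν A s≡ n≡ a≡ 0<A A≤2σ+1 extra with A ≟ 2 * σ + 1 | parity A
  ... | yes refl | _                 = fpm-a≡s-2-any σ ν s≡ n≡ a≡ extra
  ... | no _     | zero , inj₁ refl  = contradiction 0<A λ ()
  ... | no _     | suc p , inj₁ refl
    with r , refl ← m≤n⇒∃[o]m+o≡n (half-≤-odd (suc p) σ A≤2σ+1)
    = fpm-a-even-below (2 * p) (2 * r) (2 * r + 2 * ν + 1)
        (trans a≡ (solve (p ∷ []))) (trans s≡ (solve (p ∷ r ∷ []))) (trans n≡ (solve (p ∷ r ∷ ν ∷ [])))
  ... | no A≢    | k , inj₂ refl
    with r , refl ← m≤n⇒∃[o]m+o≡n (half-≤-odd (suc k) σ (let open ≤-Reasoning hiding (start) in begin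
                      2 * suc k       ≡⟨ solve (k ∷ []) ⟩
                      suc (2 * k + 1) ≤⟨ ≤∧≢⇒< A≤2σ+1 A≢ ⟩
                      2 * σ + 1       ∎))
    = fpm-a-odd-below k (2 * r + 1) (2 * r + 2 + 2 * ν)
        (trans a≡ (solve (k ∷ []))) (trans s≡ (solve (k ∷ r ∷ []))) (trans n≡ (solve (k ∷ r ∷ ν ∷ [])))

  fpm-tight : ∀ σ α β → toℕ s₁ ≡ 2 * σ + 3 → n ≡ 4 * σ + 7 → toℕ a ≡ 2 * σ + 5 + α → α + β + 1 ≡ 2 * σ →
              FractionalPerfectMatching n S Removed
  fpm-tight zero    α       β       _  _  _  α+β+1≡0 = contradiction (trans (+-comm 1 (α + β)) α+β+1≡0) λ ()
  fpm-tight (suc σ) zero    β       s≡ n≡ a≡ _ =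
    fpm-a≡s+2-tight (2 * σ) (trans a≡ (solve (σ ∷ []))) (trans s≡ (solve (σ ∷ []))) (trans n≡ (solve (σ ∷ [])))
  fpm-tight (suc σ) (suc α) zero    s≡ n≡ a≡ E =
    fpm-a≡n-3-tight (2 * σ) (trans a≡ (trans (cong (λ x → 2 * suc σ + 5 + suc x) α≡2σ) (solve (σ ∷ []))))
                            (trans s≡ (solve (σ ∷ []))) (trans n≡ (solve (σ ∷ [])))
    where
    α≡2σ : α ≡ 2 * σ
    α≡2σ = +-cancelʳ-≡ 2 α (2 * σ) (begin
      α + 2             ≡⟨ solve (α ∷ []) ⟩
      suc α + 0 + 1     ≡⟨ E ⟩
      2 * suc σ         ≡⟨ solve (σ ∷ []) ⟩
      2 * σ + 2         ∎)
      where open ≡-Reasoning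
  fpm-tight σ (suc α) (suc β) s≡ n≡ a≡ E with parity α | parity β
  ... | k , inj₂ refl | j , inj₁ refl with refl ← *-cancelˡ-≡ (k + j + 2) σ 2 (let open ≡-Reasoning in begin
                                              2 * (k + j + 2)                 ≡⟨ solve (k ∷ j ∷ []) ⟩
                                              suc (2 * k + 1) + suc (2 * j) + 1 ≡⟨ E ⟩
                                              2 * σ                           ∎) =
    fpm-odd-gap-tight k j (trans a≡ (solve (k ∷ j ∷ []))) (trans s≡ (solve (k ∷ j ∷ []))) (trans n≡ (solve (k ∷ j ∷ [])))
  ... | k , inj₁ refl | j , inj₂ refl with refl ← *-cancelˡ-≡ (k + j + 2) σ 2 (let open ≡-Reasoning in begin
                                              2 * (k + j + 2)                 ≡⟨ solve (k ∷ j ∷ []) ⟩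
                                              suc (2 * k) + suc (2 * j + 1) + 1 ≡⟨ E ⟩
                                              2 * σ                           ∎) =
    fpm-even-gap-tight k j (trans a≡ (solve (k ∷ j ∷ []))) (trans s≡ (solve (k ∷ j ∷ []))) (trans n≡ (solve (k ∷ j ∷ [])))
  ... | k , inj₁ refl | j , inj₁ refl = contradiction (begin
                                          2 * σ                         ≡⟨ E ⟨
                                          suc (2 * k) + suc (2 * j) + 1 ≡⟨ solve (k ∷ j ∷ []) ⟩
                                          suc (2 * (k + j + 1))         ∎) (even≢odd σ (k + j + 1))
    where open ≡-Reasoning
  ... | k , inj₂ refl | j , inj₂ refl = contradiction (begin
                                          2 * σ                                 ≡⟨ E ⟨
                                          suc (2 * k + 1) + suc (2 * j + 1) + 1 ≡⟨ solve (k ∷ j ∷ []) ⟩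
                                          suc (2 * (k + j + 2))                 ∎) (even≢odd σ (k + j + 2))
    where open ≡-Reasoning

  fpm-roomy : ∀ σ ν α β → toℕ s₁ ≡ 2 * σ + 3 → n ≡ 4 * σ + 2 * ν + 9 → toℕ a ≡ 2 * σ + 5 + α → α + β ≡ 2 * σ + 2 * ν + 1 →
              FractionalPerfectMatching n S Removed
  fpm-roomy σ ν α β s≡ n≡ a≡ E with 2 * σ ≤? β
  ... | yes 2σ≤β with γ , refl ← m≤n⇒∃[o]m+o≡n 2σ≤β =
    fpm-a-above 0 σ α γ (trans a≡ (solve (σ ∷ α ∷ []))) (trans s≡ (solve (σ ∷ []))) (trans n≡′ (solve (σ ∷ α ∷ γ ∷ [])))
    where
    n≡′ : n ≡ 2 * σ + 8 + (α + (2 * σ + γ))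
    n≡′ = begin
      n                               ≡⟨ n≡ ⟩
      4 * σ + 2 * ν + 9               ≡⟨ solve (σ ∷ ν ∷ []) ⟩
      2 * σ + 8 + (2 * σ + 2 * ν + 1) ≡⟨ cong (2 * σ + 8 +_) E ⟨
      2 * σ + 8 + (α + (2 * σ + γ))   ∎
      where open ≡-Reasoning
  ... | no 2σ≰β with parity β
  ...   | ρ , inj₁ refl with κ , refl ← m≤n⇒∃[o]m+o≡n (*-cancelˡ-< 2 ρ σ (≰⇒> 2σ≰β)) =
    fpm-a-above (suc κ) ρ (2 * ν + 1) 0 (trans a≡ (trans (cong (2 * suc (ρ + κ) + 5 +_) α≡) (solve (ρ ∷ κ ∷ ν ∷ []))))
                                         (trans s≡ (solve (ρ ∷ κ ∷ []))) (trans n≡ (solve (ρ ∷ κ ∷ ν ∷ [])))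
    where
    α≡ : α ≡ 2 * κ + 2 * ν + 3
    α≡ = +-cancelʳ-≡ (2 * ρ) α (2 * κ + 2 * ν + 3) (trans E (solve (ρ ∷ κ ∷ ν ∷ [])))
  ...   | ρ , inj₂ refl with κ , refl ← m≤n⇒∃[o]m+o≡n (*-cancelˡ-≤ {suc ρ} {σ} 2 (let open ≤-Reasoning hiding (start) in begin
                                           2 * suc ρ       ≡⟨ solve (ρ ∷ []) ⟩
                                           suc (2 * ρ + 1) ≤⟨ ≰⇒> 2σ≰β ⟩
                                           2 * σ           ∎)) =
    fpm-a-above (suc κ) ρ (2 * ν) 1 (trans a≡ (trans (cong (2 * suc (ρ + κ) + 5 +_) α≡) (solve (ρ ∷ κ ∷ ν ∷ []))))
                                     (trans s≡ (solve (ρ ∷ κ ∷ []))) (trans n≡ (solve (ρ ∷ κ ∷ ν ∷ [])))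
    where
    α≡ : α ≡ 2 * κ + 2 * ν + 2
    α≡ = +-cancelʳ-≡ (2 * ρ + 1) α (2 * κ + 2 * ν + 2) (trans E (solve (ρ ∷ κ ∷ ν ∷ [])))

  fpm-a-above-s : ∀ σ ν α β → toℕ s₁ ≡ 2 * σ + 3 → n ≡ 4 * σ + 2 * ν + 7 → toℕ a ≡ 2 * σ + 4 + α → 2 * σ + 6 + α + β ≡ n →
                  (σ ≡ 0 → ExtraChord n S) → FractionalPerfectMatching n S Removed
  fpm-a-above-s σ ν       zero    β       s≡ n≡ a≡ _       extra = fpm-a≡s+1-any σ ν s≡ n≡ (trans a≡ (+-identityʳ _)) extra
  fpm-a-above-s σ ν       (suc α) zero    s≡ n≡ a≡ a+2+β≡n extra = fpm-a≡n-2-any σ ν s≡ n≡ (begin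
    toℕ a + 2                ≡⟨ cong (_+ 2) a≡ ⟩
    2 * σ + 4 + suc α + 2    ≡⟨ solve (σ ∷ α ∷ []) ⟩
    2 * σ + 6 + suc α + 0    ≡⟨ a+2+β≡n ⟩
    n                        ∎) extra
    where open ≡-Reasoning
  fpm-a-above-s σ zero    (suc α) (suc β) s≡ n≡ a≡ a+2+β≡n _ =
    fpm-tight σ α β s≡ (trans n≡ (solve (σ ∷ []))) (trans a≡ (solve (σ ∷ α ∷ []))) (+-cancelˡ-≡ (2 * σ + 7) (α + β + 1) (2 * σ) (begin
      2 * σ + 7 + (α + β + 1)     ≡⟨ solve (σ ∷ α ∷ β ∷ []) ⟩
      2 * σ + 6 + suc α + suc β   ≡⟨ a+2+β≡n ⟩
      n                           ≡⟨ n≡ ⟩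
      4 * σ + 2 * 0 + 7           ≡⟨ solve (σ ∷ []) ⟩
      2 * σ + 7 + 2 * σ           ∎))
    where open ≡-Reasoning
  fpm-a-above-s σ (suc ν) (suc α) (suc β) s≡ n≡ a≡ a+2+β≡n _ =
    fpm-roomy σ ν α β s≡ (trans n≡ (solve (σ ∷ ν ∷ []))) (trans a≡ (solve (σ ∷ α ∷ [])))
      (+-cancelˡ-≡ (2 * σ + 8) (α + β) (2 * σ + 2 * ν + 1) (begin
      2 * σ + 8 + (α + β)           ≡⟨ solve (σ ∷ α ∷ β ∷ []) ⟩
      2 * σ + 6 + suc α + suc β     ≡⟨ a+2+β≡n ⟩
      n                             ≡⟨ n≡ ⟩
      4 * σ + 2 * suc ν + 7         ≡⟨ solve (σ ∷ ν ∷ []) ⟩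
      2 * σ + 8 + (2 * σ + 2 * ν + 1) ∎))
    where open ≡-Reasoning

  fpm-any-a : ∀ σ ν → toℕ s₁ ≡ 2 * σ + 3 → n ≡ 4 * σ + 2 * ν + 7 →
              toℕ a ≢ 0 → toℕ a ≢ 2 * σ + 2 → toℕ a ≢ 2 * σ + 3 → toℕ a + 2 ≤ n → (σ ≡ 0 → ExtraChord n S) →
              FractionalPerfectMatching n S Removed
  fpm-any-a σ ν s≡ n≡ a≢0 a≢s-1 a≢s a+2≤n extra with toℕ a <? 2 * σ + 3
  ... | yes a<s = fpm-a-below-s σ ν (toℕ a) s≡ n≡ refl (n≢0⇒n>0 a≢0) (≤-pred (begin
    suc (toℕ a)     ≤⟨ ≤∧≢⇒< (≤-pred (begin
                         suc (toℕ a)     ≤⟨ a<s ⟩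
                         2 * σ + 3       ≡⟨ solve (σ ∷ []) ⟩
                         suc (2 * σ + 2) ∎)) a≢s-1 ⟩
    2 * σ + 2       ≡⟨ solve (σ ∷ []) ⟩
    suc (2 * σ + 1) ∎)) extra
    where open ≤-Reasoning hiding (start)
  ... | no a≮s
    with α , s+1+α≡a ← m≤n⇒∃[o]m+o≡n (let open ≤-Reasoning hiding (start) in begin
                         2 * σ + 4       ≡⟨ solve (σ ∷ []) ⟩
                         suc (2 * σ + 3) ≤⟨ ≤∧≢⇒< (≮⇒≥ a≮s) (a≢s ∘ sym) ⟩
                         toℕ a           ∎)
    with β , a+2+β≡n ← m≤n⇒∃[o]m+o≡n a+2≤n
    = fpm-a-above-s σ ν α β s≡ n≡ (sym s+1+α≡a) (begin
        2 * σ + 6 + α + β       ≡⟨ solve (σ ∷ α ∷ β ∷ []) ⟩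
        2 * σ + 4 + α + 2 + β   ≡⟨ cong (λ x → x + 2 + β) s+1+α≡a ⟩
        toℕ a + 2 + β           ≡⟨ a+2+β≡n ⟩
        n                       ∎) extra
    where open ≡-Reasoning

odd-value : ∀ m → ¬ 2 ∣ m → ∃ λ k → m ≡ 2 * k + 1
odd-value m ¬2∣m with parity m
... | k , inj₁ m≡2k   = contradiction (divides k (trans m≡2k (*-comm 2 k))) ¬2∣m
... | k , inj₂ m≡2k+1 = k , m≡2k+1

odd>1-value : ∀ m → ¬ 2 ∣ m → 1 < m → ∃ λ σ → m ≡ 2 * σ + 3
odd>1-value m ¬2∣m 1<m with odd-value m ¬2∣m
... | zero  , refl = contradiction 1<m λ { (s≤s ()) }
... | suc σ , refl = σ , solve (σ ∷ [])

half-of-odd : ∀ {n} k → n ≡ 2 * k + 1 → (n ∸ 1) / 2 ≡ k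
half-of-odd k refl = trans (cong (_/ 2) (trans (m+n∸n≡m (2 * k) 1) (*-comm 2 k))) (m*n/n≡m k 2)

fpm-normalised : ∀ n .{{_ : NonZero n}} k σ ν → n ≡ 2 * k + 1 → n ≡ 4 * σ + 2 * ν + 7 →
                 (s₁ : Fin n) → toℕ s₁ ≡ 2 * σ + 3 →
                 (S : Subset n) → (∀ x → x ∈ S → neg n x ∈ S) → ⟦ n ⟧ 1 ∈ S → s₁ ∈ S → ((⟦ n ⟧ 2 ∉ S × ⟦ n ⟧ 3 ∉ S) ⊎ 6 ≤ ∣ S ∣) →
                 (a : Fin n) → a ≢ ⟦ n ⟧ (n ∸ 1) → a ≢ ⟦ n ⟧ 0 → a ≢ sub n s₁ (⟦ n ⟧ 1) → a ≢ s₁ →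
                 FractionalPerfectMatching n S (set4 (⟦ n ⟧ 0) s₁ a (add n a (⟦ n ⟧ 1)))
fpm-normalised n k σ ν n≡2k+1 n≡ s₁ s≡ S S-symmetric 1∈S s₁∈S small-or-large a a≢n-1 a≢0 a≢s-1 a≢s =
  Construction.fpm-any-a n S s₁ a 1<n 1∈S S-symmetric s₁∈S toℕ-a+1 σ ν s≡ n≡
    (≢-toℕ a≢0 (toℕ-⟦⟧ 0<n)) (≢-toℕ a≢s-1 toℕ-s-1) (≢-toℕ a≢s s≡) a+2≤n extra
  where
  n≡1+2k : n ≡ suc (2 * k)
  n≡1+2k = trans n≡2k+1 (+-comm (2 * k) 1)
  0<n : 0 < n
  0<n = subst (0 <_) (sym n≡1+2k) (s≤s z≤n)
  1<n : 1 < n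
  1<n = subst (1 <_) (sym n≡) (≤-trans (s≤s (s≤s z≤n)) (m≤n+m 7 (4 * σ + 2 * ν)))
  ≢-toℕ : ∀ {x y : Fin n} {c} → x ≢ y → toℕ y ≡ c → toℕ x ≢ c
  ≢-toℕ x≢y y≡c x≡c = x≢y (toℕ-injective (trans x≡c (sym y≡c)))
  n-1<n : n ∸ 1 < n
  n-1<n = subst (λ m → m ∸ 1 < m) (sym n≡1+2k) ≤-refl
  a+1<n : suc (toℕ a) < n
  a+1<n = ≤∧≢⇒< (toℕ<n a) (λ a+1≡n → ≢-toℕ a≢n-1 (toℕ-⟦⟧ n-1<n) (cong (_∸ 1) a+1≡n))
  a+2≤n : toℕ a + 2 ≤ n
  a+2≤n = subst (_≤ n) (+-comm 2 (toℕ a)) a+1<n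
  toℕ-a+1 : toℕ (add n a (⟦ n ⟧ 1)) ≡ suc (toℕ a)
  toℕ-a+1 = toℕ-add-1 a 1<n a+1<n
  toℕ-s-1 : toℕ (sub n s₁ (⟦ n ⟧ 1)) ≡ 2 * σ + 2
  toℕ-s-1 = toℕ-sub-1 s₁ 1<n (trans s≡ (solve (σ ∷ [])))
  extra : σ ≡ 0 → ExtraChord n S
  extra σ≡0 = from-assumption small-or-large
    where
    7≤n : 7 ≤ n
    7≤n = subst (7 ≤_) (sym (trans n≡ (cong (λ x → 4 * x + 2 * ν + 7) σ≡0))) (m≤n+m 7 (4 * 0 + 2 * ν))
    s₁≡3 : s₁ ≡ ⟦ n ⟧ 3
    s₁≡3 = toℕ-injective (trans s≡ (trans (cong (λ x → 2 * x + 3) σ≡0) (sym (toℕ-⟦⟧ (<-≤-trans (s≤s (s≤s (s≤s (s≤s z≤n)))) 7≤n)))))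
    from-assumption : (⟦ n ⟧ 2 ∉ S × ⟦ n ⟧ 3 ∉ S) ⊎ 6 ≤ ∣ S ∣ → ExtraChord n S
    from-assumption (inj₁ (_ , 3∉S)) = contradiction (subst (_∈ S) s₁≡3 s₁∈S) 3∉S
    from-assumption (inj₂ 6≤∣S∣)     = extra-chord n S k n≡2k+1 7≤n S-symmetric 6≤∣S∣

fpm-when-s-odd : ∀ n .{{_ : NonZero n}} → n % 2 ≡ 1 →
                 (s₁ : Fin n) → 1 < toℕ s₁ → toℕ s₁ ≤ (n ∸ 1) / 2 → ¬ 2 ∣ toℕ s₁ →
                 (S : Subset n) → (∀ x → x ∈ S → neg n x ∈ S) → ⟦ n ⟧ 1 ∈ S → s₁ ∈ S → ((⟦ n ⟧ 2 ∉ S × ⟦ n ⟧ 3 ∉ S) ⊎ 6 ≤ ∣ S ∣) →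
                 (a : Fin n) → a ≢ ⟦ n ⟧ (n ∸ 1) → a ≢ ⟦ n ⟧ 0 → a ≢ sub n s₁ (⟦ n ⟧ 1) → a ≢ s₁ →
                 FractionalPerfectMatching n S (set4 (⟦ n ⟧ 0) s₁ a (add n a (⟦ n ⟧ 1)))
fpm-when-s-odd n n-odd s₁ 1<s s≤ ¬2∣s S S-symmetric 1∈S s₁∈S small-or-large a
  with k , n≡2k+1 ← odd-value n (λ 2∣n → contradiction (trans (sym (n∣m⇒m%n≡0 n 2 2∣n)) n-odd) λ ())
  with σ , s≡ ← odd>1-value (toℕ s₁) ¬2∣s 1<s
  with ν , s+ν≡k ← m≤n⇒∃[o]m+o≡n (subst (toℕ s₁ ≤_) (half-of-odd k n≡2k+1) s≤)
  = fpm-normalised n k σ ν n≡2k+1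
      (trans n≡2k+1 (trans (cong (λ x → 2 * x + 1) (sym s+ν≡k)) (trans (cong (λ x → 2 * (x + ν) + 1) s≡) (solve (σ ∷ ν ∷ [])))))
      s₁ s≡ S S-symmetric 1∈S s₁∈S small-or-large a

lemma3p12 : (n : ℕ) .{{_ : NonZero n}} → 5 ≤ n → n % 2 ≡ 1 →
    (s₁ : Fin n) → 1 < toℕ s₁ → toℕ s₁ ≤ (n ∸ 1) / 2 →
    (S : Subset n) → ⟦ n ⟧ 0 ∉ S → (∀ x → (neg n x ∈ S → x ∈ S) × (x ∈ S → neg n x ∈ S)) →
    ⟦ n ⟧ 1 ∈ S → s₁ ∈ S →
    ((⟦ n ⟧ 2 ∉ S × ⟦ n ⟧ 3 ∉ S) ⊎ 6 ≤ ∣ S ∣) →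
    (a : Fin n) → a ≢ ⟦ n ⟧ (n ∸ 1) → a ≢ ⟦ n ⟧ 0 → a ≢ sub n s₁ (⟦ n ⟧ 1) → a ≢ s₁ →
    ¬ FractionalPerfectMatching n S (set4 (⟦ n ⟧ 0) s₁ a (add n a (⟦ n ⟧ 1))) →
    2 ∣ toℕ s₁
lemma3p12 n _ n-odd s₁ 1<s s≤ S _ S-symmetric 1∈S s₁∈S small-or-large a a≢n-1 a≢0 a≢s-1 a≢s no-fpm with 2 ∣? toℕ s₁
... | yes 2∣s  = 2∣s
... | no ¬2∣s = contradiction (fpm-when-s-odd n n-odd s₁ 1<s s≤ ¬2∣s S (λ x → proj₂ (S-symmetric x)) 1∈S s₁∈S small-or-large
                                              a a≢n-1 a≢0 a≢s-1 a≢s)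
                              no-fpm
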